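{- Let $u,v\in S_n$. The minimal weight of a shortest directed path from $u$ to $v$ in the quantum Bruhat graph $\Gamma_n$ equals \[q_1^{d_1(u,v)}q_2^{d_2(u,v)}\cdots q_{n-1}^{d_{n-1}(u,v)},\qquad\text{where } d_k(u,v):=\operatorname{depth}(u[k],v[k])\ \text{ for } k\in[n-1].\]
   Context: Permutations $w\in S_n$ are written in one-line notation $w=w_1w_2\cdots w_n$, and $w[k]:=\{w_1,\dots,w_k\}$. For $i<j$, $t_{ij}$ is the transposition $(i\ j)$, and $wt_{ij}$ is the permutation obtained from $w$ by swapping the entries in positions $i$ and $j$; $\ell(w)$ is the number of inversions of $w$. The quantum Bruhat graph $\Gamma_n$ is the directed weighted graph on $S_n$ with an edge $w\to wt_{ij}$ ($1\le i<j\le n$) of weight $1$ if $\ell(wt_{ij})=\ell(w)+1$, and of weight $q_{ij}:=q_iq_{i+1}\cdots q_{j-1}$ if $\ell(wt_{ij})=\ell(w)+1-2(j-i)$; there are no other edges. The weight of a directed path is the product of the weights of its edges. For $A,B\subseteq[n]$ with $|A|=|B|$, the lattice path $\Lambda(A,B)$ starts at $(1,0)$ and takes $n$ steps, the $i$-th step being $(1,1)$ if $i\in A\setminus B$, $(1,-1)$ if $i\in B\setminus A$, and $(1,0)$ otherwise (ending at $(n+1,0)$). $\operatorname{depth}(A,B)$ is the largest $y\ge 0$ such that $\Lambda(A,B)$ passes through a point $(x,-y)$. -}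

module Defs where

open import Data.Nat using (ℕ; zero; suc; _+_; _*_; _∸_; _≤_; _<_; _<ᵇ_; _⊔_)
open import Data.Bool using (Bool; true; false; _∧_; not; if_then_else_)
open import Data.Fin using (Fin; toℕ; _≟_)
import Data.Fin as F
open import Data.Vec using (Vec; lookup; _[_]≔_)
open import Data.List using (List; []; _∷_; map; allFin; upTo; foldr)
open import Data.Nat.ListAction using (sum)
open import Data.Bool.ListAction using (any)
open import Data.Integer as ℤ using (ℤ; +_; -[1+_])
open import Relation.Nullary.Decidable using (⌊_⌋)
open import Relation.Binary.PropositionalEquality using (_≡_)

-- A word in one-line notation w = w_1 ... w_n; entries (values) and
-- positions are 0-based elements of Fin n (value x stands for x+1).
Word : ℕ → Set
Word n = Vec (Fin n) n

IsPerm : ∀ {n} → Word n → Set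
IsPerm {n} w = ∀ (i j : Fin n) → lookup w i ≡ lookup w j → i ≡ j

swap : ∀ {n} → Word n → Fin n → Fin n → Word n
swap w i j = (w [ i ]≔ lookup w j) [ j ]≔ lookup w i

inv : ∀ {n} → Word n → ℕ
inv {n} w = sum (map (λ i → sum (map (λ j →
  if (toℕ i <ᵇ toℕ j) ∧ (toℕ (lookup w j) <ᵇ toℕ (lookup w i)) then 1 else 0)
  (allFin n))) (allFin n))

data Edge {n : ℕ} (w w' : Word n) : Set where
  bruhat  : (i j : Fin n) → i F.< j → w' ≡ swap w i j →
            inv w' ≡ suc (inv w) → Edge w w'
  -- ℓ(w t_ij) = ℓ(w) + 1 - 2(j-i), written without subtraction
  quantum : (i j : Fin n) → i F.< j → w' ≡ swap w i j →
            inv w' + 2 * (toℕ j ∸ toℕ i) ≡ suc (inv w) → Edge w w'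

-- Weights are monomials in q_1,q_2,...; a weight is represented by its
-- exponent function k ↦ (exponent of q_k), k ≥ 1.
-- q_{ij} = q_i ... q_{j-1} in 1-based positions; for 0-based positions
-- i,j this is the set of k with toℕ i < k ≤ toℕ j.
edgeExp : ∀ {n} {w w' : Word n} → Edge w w' → ℕ → ℕ
edgeExp (bruhat i j _ _ _) k = 0
edgeExp (quantum i j _ _ _) k = if (toℕ i <ᵇ k) ∧ (k <ᵇ suc (toℕ j)) then 1 else 0

data Path {n : ℕ} : Word n → Word n → Set where
  []  : ∀ {w} → Path w w
  _∷_ : ∀ {u w v} → Edge u w → Path w v → Path u v

len : ∀ {n} {u v : Word n} → Path u v → ℕ
len [] = 0
len (e ∷ p) = suc (len p)

pathExp : ∀ {n} {u v : Word n} → Path u v → ℕ → ℕ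
pathExp [] k = 0
pathExp (e ∷ p) k = edgeExp e k + pathExp p k

-- w[k] = {w_1, ..., w_k} as a characteristic function on values
prefixSet : ∀ {n} → Word n → ℕ → Fin n → Bool
prefixSet {n} w k x = any (λ p → (toℕ p <ᵇ k) ∧ ⌊ lookup w p ≟ x ⌋) (allFin n)

-- i-th step of Λ(A,B) (vertical component)
step : ∀ {n} → (Fin n → Bool) → (Fin n → Bool) → Fin n → ℤ
step A B x = if A x ∧ not (B x) then + 1
             else (if B x ∧ not (A x) then -[1+ 0 ] else + 0)

-- height of Λ(A,B) after the first i steps (at the point with x-coordinate i+1)
height : ∀ {n} → (Fin n → Bool) → (Fin n → Bool) → ℕ → ℤ
height {n} A B i = foldr ℤ._+_ (+ 0)
  (map (λ x → if toℕ x <ᵇ i then step A B x else + 0) (allFin n))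

negPart : ℤ → ℕ
negPart (+ _) = 0
negPart -[1+ m ] = suc m

-- depth(A,B): largest y ≥ 0 such that Λ(A,B) passes through some (x,-y)
depth : ∀ {n} → (Fin n → Bool) → (Fin n → Bool) → ℕ
depth {n} A B = foldr _⊔_ 0 (map (λ i → negPart (height A B i)) (upTo (suc n)))

-- Let u, v be permutations and write P_w(k, x) = #{p < k : w_p < x}. The height of Λ(u[k], v[k])
-- after x steps is P_u(k, x) − P_v(k, x), so d_k(u, v) is the largest deficit P_v(k, x) − P_u(k, x).
-- Along an edge w → w t_ij these counts grow by at most the exponent of q_k in the edge weight, so
-- d_k(·, v) drops by at most that exponent and every path from u to v has q_k-exponent ≥ d_k(u, v).
-- A greedy path attains all these bounds. Let i be the first position with u_i ≠ v_i =: c. If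
-- u_i < c, swap i with the first j > i such that u_i < u_j ≤ c: a Bruhat edge keeping every d_k.
-- If u_i > c, let j be the first position after i with u_j ≤ c and s the position of the largest
-- entry of u in [i, j); swapping s and j is a quantum edge lowering d_k by one exactly for
-- s < k ≤ j. Each edge changes ℓ by 1 − 2·(its total q-degree), so the length of a path is
-- ℓ(v) − ℓ(u) + 2·(total q-degree of its weight), and the greedy path is also a shortest one.

module Submission where

open import Defs
open import Data.Nat using (ℕ; _≤_; _<_)
open import Data.Product using (Σ; _×_)
open import Relation.Binary.PropositionalEquality using (_≡_)

open import Data.Bool using (Bool; true; false; _∧_; _∨_; if_then_else_)
open import Data.Bool.Properties using (T-≡; ¬-not; ∧-zeroʳ; ∧-identityʳ; ∨-identityʳ; ∨-zeroʳ; ∨-comm; ∨-assoc)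
open import Data.Bool.ListAction using (or)
open import Data.Nat using (zero; suc; _+_; _*_; _∸_; _⊔_; _<ᵇ_; _≡ᵇ_; z≤n; s≤s; _≟_; _<?_; _≤?_)
open import Data.Nat.Properties
open import Data.Nat.Tactic.RingSolver using (solve-∀)
open import Algebra.Properties.CommutativeSemigroup +-commutativeSemigroup using (interchange; xy∙z≈xz∙y)
open import Data.Product using (∃; _,_; proj₁; proj₂; uncurry)
open import Data.Sum using (_⊎_; inj₁; inj₂; [_,_]′)
open import Data.Fin using (Fin; toℕ; fromℕ<; punchOut)
import Data.Fin as F
open import Data.Fin.Properties using (toℕ-injective; toℕ<n; toℕ-fromℕ<; any?; pigeonhole; punchOut-injective)
open import Data.Vec using (Vec; []; _∷_; lookup; _[_]≔_)
import Data.Vec as V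
open import Data.Vec.Properties using (lookup∘update; lookup∘update′; tabulate∘lookup; tabulate-cong; ≡-dec)
open import Data.Integer as ℤ using (ℤ; _⊖_) renaming (+_ to pos)
open import Data.Integer.Properties using ([+m]-[+n]≡m⊖n; pos-+; ⊖-<; ⊖-≥)
open import Data.Integer.Tactic.RingSolver renaming (solve-∀ to ℤ-solve-∀)
open import Data.List as L using (_∷_; foldr)
open import Data.List.Properties using (map-tabulate; foldr-preservesᵇ)
open import Data.List.Membership.Propositional using (_∈_)
open import Data.List.Membership.Propositional.Properties using (∈-map⁺; ∈-upTo⁺)
open import Data.List.Relation.Unary.Any using (here; there)
import Data.List.Relation.Unary.All.Properties as All
open import Data.List.Relation.Unary.All.Properties using (applyUpTo⁺₁)
open import Data.Nat.ListAction using (sum)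
open import Function using (_∘_; _$_; id)
open import Function.Bundles using (Equivalence)
open import Relation.Binary.Definitions using (tri<; tri≈; tri>)
open import Relation.Binary.PropositionalEquality
  using (_≢_; ≢-sym; refl; sym; trans; cong; cong₂; subst; subst₂; module ≡-Reasoning)
open import Relation.Nullary using (¬_; Dec; yes; no; contradiction)
open import Relation.Nullary.Decidable using (⌊_⌋; ¬?; _×-dec_; decidable-stable)

private
  variable
    i j k m n p q x : ℕ
    g h : ℕ → ℕ

𝟙 : Bool → ℕ
𝟙 b = if b then 1 else 0

𝟙≤1 : ∀ b → 𝟙 b ≤ 1
𝟙≤1 true  = ≤-refl
𝟙≤1 false = z≤n

𝟙-∧ : ∀ a b → 𝟙 (a ∧ b) ≡ 𝟙 a * 𝟙 b
𝟙-∧ true  b = sym (+-identityʳ (𝟙 b))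
𝟙-∧ false b = refl

<ᵇ-true : m < n → (m <ᵇ n) ≡ true
<ᵇ-true = Equivalence.to T-≡ ∘ <⇒<ᵇ

<ᵇ-false : n ≤ m → (m <ᵇ n) ≡ false
<ᵇ-false {n} {m} n≤m = ¬-not λ m<ᵇn → ≤⇒≯ n≤m (<ᵇ⇒< m n (Equivalence.from T-≡ m<ᵇn))

<ᵇ-sound : (m <ᵇ n) ≡ true → m < n
<ᵇ-sound {m} {n} m<ᵇn = <ᵇ⇒< m n (Equivalence.from T-≡ m<ᵇn)

≡ᵇ-refl : ∀ m → (m ≡ᵇ m) ≡ true
≡ᵇ-refl m = Equivalence.to T-≡ (≡⇒≡ᵇ m m refl)

≡ᵇ-false : m ≢ n → (m ≡ᵇ n) ≡ false
≡ᵇ-false {m} {n} m≢n = ¬-not λ m≡ᵇn → m≢n (≡ᵇ⇒≡ m n (Equivalence.from T-≡ m≡ᵇn))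

𝟙-<-true : m < n → 𝟙 (m <ᵇ n) ≡ 1
𝟙-<-true = cong 𝟙 ∘ <ᵇ-true

𝟙-<-false : n ≤ m → 𝟙 (m <ᵇ n) ≡ 0
𝟙-<-false = cong 𝟙 ∘ <ᵇ-false

𝟙-<-antitoneˡ : ∀ x → m ≤ n → 𝟙 (n <ᵇ x) ≤ 𝟙 (m <ᵇ x)
𝟙-<-antitoneˡ {m} {n} x m≤n with n <? x
... | yes n<x rewrite 𝟙-<-true n<x | 𝟙-<-true (≤-<-trans m≤n n<x) = ≤-refl
... | no  n≮x rewrite 𝟙-<-false {x} {n} (≮⇒≥ n≮x) = z≤n

𝟙-<-monotoneʳ : ∀ y → m ≤ n → 𝟙 (y <ᵇ m) ≤ 𝟙 (y <ᵇ n)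
𝟙-<-monotoneʳ {m} {n} y m≤n with y <? m
... | yes y<m rewrite 𝟙-<-true y<m | 𝟙-<-true (<-≤-trans y<m m≤n) = ≤-refl
... | no  y≮m rewrite 𝟙-<-false {m} {y} (≮⇒≥ y≮m) = z≤n

∑ : ℕ → (ℕ → ℕ) → ℕ
∑ zero    g = 0
∑ (suc k) g = ∑ k g + g k

syntax ∑ k (λ p → e) = ∑[ p < k ] e

∑-cong : ∀ k → (∀ p → p < k → g p ≡ h p) → ∑ k g ≡ ∑ k h
∑-cong zero    eq = refl
∑-cong (suc k) eq = cong₂ _+_ (∑-cong k λ p p<k → eq p (m<n⇒m<1+n p<k)) (eq k ≤-refl)

∑-mono-≤ : ∀ k → (∀ p → p < k → g p ≤ h p) → ∑ k g ≤ ∑ k h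
∑-mono-≤ zero    le = z≤n
∑-mono-≤ (suc k) le = +-mono-≤ (∑-mono-≤ k λ p p<k → le p (m<n⇒m<1+n p<k)) (le k ≤-refl)

∑-mono-< : i < k → (∀ p → p < k → g p ≤ h p) → g i < h i → ∑ k g < ∑ k h
∑-mono-< {i} {suc k} i<1+k le lt with i ≟ k
... | yes refl = +-mono-≤-< (∑-mono-≤ k λ p p<k → le p (m<n⇒m<1+n p<k)) lt
... | no  i≢k  = +-mono-<-≤ (∑-mono-< (≤∧≢⇒< (≤-pred i<1+k) i≢k) (λ p p<k → le p (m<n⇒m<1+n p<k)) lt)
                            (le k ≤-refl)

∑-zero : ∀ k → (∀ p → p < k → g p ≡ 0) → ∑ k g ≡ 0
∑-zero zero    eq = refl
∑-zero (suc k) eq = cong₂ _+_ (∑-zero k λ p p<k → eq p (m<n⇒m<1+n p<k)) (eq k ≤-refl)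

∑-distrib-+ : ∀ k → ∑[ p < k ] (g p + h p) ≡ ∑ k g + ∑ k h
∑-distrib-+ zero = refl
∑-distrib-+ {g} {h} (suc k) =
  trans (cong (_+ (g k + h k)) (∑-distrib-+ {g} {h} k)) (interchange (∑ k g) (∑ k h) (g k) (h k))

∑-distribˡ-* : ∀ c k → ∑[ p < k ] (c * g p) ≡ c * ∑ k g
∑-distribˡ-* c zero    = sym (*-zeroʳ c)
∑-distribˡ-* {g} c (suc k) = trans (cong (_+ c * g k) (∑-distribˡ-* c k)) (sym (*-distribˡ-+ c _ _))

∑-≤-* : ∀ k c → (∀ p → p < k → g p ≤ c) → ∑ k g ≤ k * c
∑-≤-* zero    c le = z≤n
∑-≤-* (suc k) c le = ≤-trans (+-mono-≤ (∑-≤-* k c λ p p<k → le p (m<n⇒m<1+n p<k)) (le k ≤-refl))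
                             (≤-reflexive (+-comm (k * c) c))

∑-suc : ∀ k → ∑ (suc k) g ≡ g 0 + ∑[ p < k ] g (suc p)
∑-suc {g} zero    = +-comm 0 (g 0)
∑-suc {g} (suc k) = trans (cong (_+ g (suc k)) (∑-suc k)) (+-assoc (g 0) _ _)

∑-update : ∀ k → p < k → (∀ q → q < k → q ≢ p → g q ≡ h q) → ∑ k g + h p ≡ ∑ k h + g p
∑-update {p} {g} {h} (suc k) p<1+k eq with p ≟ k
... | yes refl = begin
  ∑ p g + g p + h p ≡⟨ cong (λ s → s + g p + h p) (∑-cong p λ q q<p → eq q (m<n⇒m<1+n q<p) (<⇒≢ q<p)) ⟩
  ∑ p h + g p + h p ≡⟨ xy∙z≈xz∙y (∑ p h) (g p) (h p) ⟩
  ∑ p h + h p + g p ∎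
  where open ≡-Reasoning
... | no  p≢k = begin
  ∑ k g + g k + h p ≡⟨ xy∙z≈xz∙y (∑ k g) (g k) (h p) ⟩
  ∑ k g + h p + g k ≡⟨ cong₂ _+_ (∑-update k (≤∧≢⇒< (≤-pred p<1+k) p≢k) λ q q<k → eq q (m<n⇒m<1+n q<k))
                                 (eq k ≤-refl (p≢k ∘ sym)) ⟩
  ∑ k h + g p + h k ≡⟨ xy∙z≈xz∙y (∑ k h) (g p) (h k) ⟩
  ∑ k h + h k + g p ∎
  where open ≡-Reasoning

∑-truncate : j ≤ n → (∀ m → j ≤ m → m < n → g m ≡ 0) → ∑ n g ≡ ∑ j g
∑-truncate {j} {n} {g} j≤n eq with m≤n⇒∃[o]m+o≡n j≤n
... | d , refl = go d λ m j≤m m<j+d → eq m j≤m m<j+d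
  where
  go : ∀ d → (∀ m → j ≤ m → m < j + d → g m ≡ 0) → ∑ (j + d) g ≡ ∑ j g
  go zero    eq = cong (λ l → ∑ l g) (+-identityʳ j)
  go (suc d) eq rewrite +-suc j d =
    trans (cong₂ _+_ (go d λ m j≤m m<j+d → eq m j≤m (m<n⇒m<1+n m<j+d)) (eq (j + d) (m≤m+n j d) ≤-refl))
          (+-identityʳ (∑ j g))

∑-interval : ∀ i → j ≤ n → ∑[ m < n ] 𝟙 ((i <ᵇ m) ∧ (m <ᵇ j)) ≡ j ∸ suc i
∑-interval {j} {n} i j≤n =
  trans (∑-truncate j≤n λ m j≤m _ → trans (cong (λ b → 𝟙 ((i <ᵇ m) ∧ b)) (<ᵇ-false j≤m)) (cong 𝟙 (∧-zeroʳ _)))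
        (below j ≤-refl)
  where
  below : ∀ n → n ≤ j → ∑[ m < n ] 𝟙 ((i <ᵇ m) ∧ (m <ᵇ j)) ≡ n ∸ suc i
  below zero    _     = refl
  below (suc n) n<j rewrite below n (≤-trans (n≤1+n n) n<j) | <ᵇ-true n<j | ∧-identityʳ (i <ᵇ n) with i <? n
  ... | yes i<n rewrite <ᵇ-true i<n = trans (+-comm _ 1) (sym (+-∸-assoc 1 i<n))
  ... | no  i≮n rewrite <ᵇ-false (≮⇒≥ i≮n) =
    trans (+-identityʳ _) (trans (m≤n⇒m∸n≡0 (≤-trans (≮⇒≥ i≮n) (n≤1+n i))) (sym (m≤n⇒m∸n≡0 (≮⇒≥ i≮n))))

transpose : ℕ → ℕ → ℕ → ℕ
transpose i j p = if p ≡ᵇ i then j else if p ≡ᵇ j then i else p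

transpose-ˡ : ∀ i j → transpose i j i ≡ j
transpose-ˡ i j rewrite ≡ᵇ-refl i = refl

transpose-ʳ : i ≢ j → transpose i j j ≡ i
transpose-ʳ {i} {j} i≢j rewrite ≡ᵇ-false (i≢j ∘ sym) | ≡ᵇ-refl j = refl

transpose-other : p ≢ i → p ≢ j → transpose i j p ≡ p
transpose-other p≢i p≢j rewrite ≡ᵇ-false p≢i | ≡ᵇ-false p≢j = refl

transpose-involutive : i ≢ j → ∀ p → transpose i j (transpose i j p) ≡ p
transpose-involutive {i} {j} i≢j p with p ≟ i | p ≟ j
... | yes refl | _        = trans (cong (transpose i j) (transpose-ˡ i j)) (transpose-ʳ i≢j)
... | no  p≢i  | yes refl = trans (cong (transpose i j) (transpose-ʳ i≢j)) (transpose-ˡ i j)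
... | no  p≢i  | no  p≢j  = trans (cong (transpose i j) (transpose-other p≢i p≢j)) (transpose-other p≢i p≢j)

transpose-< : i < n → j < n → p < n → transpose i j p < n
transpose-< {i} {n} {j} {p} i<n j<n p<n with p ≟ i | p ≟ j
... | yes refl | _        = subst (_< n) (sym (transpose-ˡ i j)) j<n
... | no  p≢i  | yes refl = subst (_< n) (sym (transpose-ʳ (p≢i ∘ sym))) i<n
... | no  p≢i  | no  p≢j  = subst (_< n) (sym (transpose-other p≢i p≢j)) p<n

InjectiveBelow : ℕ → (ℕ → ℕ) → Set
InjectiveBelow n W = ∀ {p q} → p < n → q < n → W p ≡ W q → p ≡ q

injectiveBelow-transpose : ∀ {W : ℕ → ℕ} → i < n → j < n → i ≢ j → InjectiveBelow n W → InjectiveBelow n (W ∘ transpose i j)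
injectiveBelow-transpose {i} {n} {j} i<n j<n i≢j inj {p} {q} p<n q<n eq = begin
  p                         ≡⟨ transpose-involutive i≢j p ⟨
  transpose i j (transpose i j p) ≡⟨ cong (transpose i j) (inj (transpose-< i<n j<n p<n) (transpose-< i<n j<n q<n) eq) ⟩
  transpose i j (transpose i j q) ≡⟨ transpose-involutive i≢j q ⟩
  q                         ∎
  where open ≡-Reasoning

∑-transpose : i < n → j < n → i ≢ j → ∑[ p < n ] g (transpose i j p) ≡ ∑ n g
∑-transpose {i} {n} {j} {g} i<n j<n i≢j = +-cancelʳ-≡ (g i) _ _ $ begin
  ∑ n (g ∘ τ) + g i   ≡⟨ cong (λ b → ∑ n (g ∘ τ) + (if b then g i else g (τ i))) (≡ᵇ-refl i) ⟨
  ∑ n (g ∘ τ) + g′ i  ≡⟨ ∑-update n i<n (λ q _ q≢i → sym (cong (λ b → if b then g i else g (τ q)) (≡ᵇ-false q≢i))) ⟩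
  ∑ n g′ + g (τ i)     ≡⟨ cong (λ p → ∑ n g′ + g p) (transpose-ˡ i j) ⟩
  ∑ n g′ + g j         ≡⟨ ∑-update n j<n g′≗g ⟩
  ∑ n g + g′ j         ≡⟨ cong (∑ n g +_) (trans (cong (λ b → if b then g i else g (τ j)) (≡ᵇ-false (i≢j ∘ sym)))
                                                (cong g (transpose-ʳ i≢j))) ⟩
  ∑ n g + g i ∎
  where
  open ≡-Reasoning
  τ : ℕ → ℕ
  τ = transpose i j
  g′ : ℕ → ℕ
  g′ q = if q ≡ᵇ i then g i else g (τ q)
  g′≗g : ∀ q → q < n → q ≢ j → g′ q ≡ g q
  g′≗g q _ q≢j with q ≟ i
  ... | yes refl = cong (λ b → if b then g q else g (τ q)) (≡ᵇ-refl q)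
  ... | no  q≢i  = trans (cong (λ b → if b then g i else g (τ q)) (≡ᵇ-false q≢i)) (cong g (transpose-other q≢i q≢j))

entry : ∀ {n l} → Vec (Fin n) l → ℕ → ℕ
entry []       _       = 0
entry (x ∷ xs) zero    = toℕ x
entry (x ∷ xs) (suc p) = entry xs p

entry-lookup : ∀ {n l} (w : Vec (Fin n) l) (q : Fin l) → entry w (toℕ q) ≡ toℕ (lookup w q)
entry-lookup (x ∷ w) F.zero    = refl
entry-lookup (x ∷ w) (F.suc q) = entry-lookup w q

entry-fromℕ< : (w : Word n) (p<n : p < n) → entry w p ≡ toℕ (lookup w (fromℕ< p<n))
entry-fromℕ< w p<n = trans (cong (entry w) (sym (toℕ-fromℕ< p<n))) (entry-lookup w (fromℕ< p<n))

entry-< : (w : Word n) → p < n → entry w p < n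
entry-< w p<n = subst (_< _) (sym (entry-fromℕ< w p<n)) (toℕ<n _)

toFin : p < n → Σ (Fin n) λ f → toℕ f ≡ p
toFin p<n = fromℕ< p<n , toℕ-fromℕ< p<n

isPerm⇒injectiveBelow : (w : Word n) → IsPerm w → InjectiveBelow n (entry w)
isPerm⇒injectiveBelow w w-perm {p} {q} p<n q<n eq = begin
  p                      ≡⟨ toℕ-fromℕ< p<n ⟨
  toℕ (fromℕ< p<n)        ≡⟨ cong toℕ (w-perm _ _ (toℕ-injective (begin
    toℕ (lookup w (fromℕ< p<n)) ≡⟨ entry-fromℕ< w p<n ⟨
    entry w p                   ≡⟨ eq ⟩
    entry w q                   ≡⟨ entry-fromℕ< w q<n ⟩
    toℕ (lookup w (fromℕ< q<n)) ∎))) ⟩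
  toℕ (fromℕ< q<n)        ≡⟨ toℕ-fromℕ< q<n ⟩
  q                      ∎
  where open ≡-Reasoning

injectiveBelow⇒isPerm : (w : Word n) → InjectiveBelow n (entry w) → IsPerm w
injectiveBelow⇒isPerm w inj i j eq = toℕ-injective $
  inj (toℕ<n i) (toℕ<n j) (trans (entry-lookup w i) (trans (cong toℕ eq) (sym (entry-lookup w j))))

injective⇒surjective : (f : Fin n → Fin n) → (∀ i j → f i ≡ f j → i ≡ j) → ∀ c → ∃ λ i → f i ≡ c
injective⇒surjective {suc n} f f-inj c with any? (λ i → f i F.≟ c)
... | yes hit = hit
... | no  miss with pigeonhole (n<1+n n) (λ i → punchOut (λ eq → miss (i , sym eq)))
...   | i , j , i<j , eq = contradiction
  (f-inj i j (punchOut-injective (λ eq → miss (i , sym eq)) (λ eq → miss (j , sym eq)) eq))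
  (λ i≡j → <⇒≢ i<j (cong toℕ i≡j))

isPerm⇒surjective : (w : Word n) → IsPerm w → x < n → ∃ λ p → p < n × entry w p ≡ x
isPerm⇒surjective w w-perm x<n with injective⇒surjective (lookup w) w-perm (fromℕ< x<n)
... | i , eq = toℕ i , toℕ<n i , trans (entry-lookup w i) (trans (cong toℕ eq) (toℕ-fromℕ< x<n))

entry-injective : (u v : Word n) → (∀ p → p < n → entry u p ≡ entry v p) → u ≡ v
entry-injective u v eq = begin
  u                 ≡⟨ tabulate∘lookup u ⟨
  V.tabulate (lookup u) ≡⟨ tabulate-cong (λ q → toℕ-injective (begin
    toℕ (lookup u q) ≡⟨ entry-lookup u q ⟨
    entry u (toℕ q)  ≡⟨ eq (toℕ q) (toℕ<n q) ⟩
    entry v (toℕ q)  ≡⟨ entry-lookup v q ⟩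
    toℕ (lookup v q) ∎)) ⟩
  V.tabulate (lookup v) ≡⟨ tabulate∘lookup v ⟩
  v                 ∎
  where open ≡-Reasoning

lookup-swap : (w : Word n) (i j : Fin n) → i ≢ j → ∀ q →
              toℕ (lookup (swap w i j) q) ≡ entry w (transpose (toℕ i) (toℕ j) (toℕ q))
lookup-swap w i j i≢j q with q F.≟ j | q F.≟ i
... | yes refl | _        = begin
  toℕ (lookup (swap w i q) q) ≡⟨ cong toℕ (lookup∘update q (w [ i ]≔ lookup w q) (lookup w i)) ⟩
  toℕ (lookup w i)            ≡⟨ entry-lookup w i ⟨
  entry w (toℕ i)             ≡⟨ cong (entry w) (transpose-ʳ (i≢j ∘ toℕ-injective)) ⟨
  entry w (transpose (toℕ i) (toℕ q) (toℕ q)) ∎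
  where open ≡-Reasoning
... | no  q≢j  | yes refl = begin
  toℕ (lookup (swap w q j) q) ≡⟨ cong toℕ (lookup∘update′ q≢j (w [ q ]≔ lookup w j) (lookup w q)) ⟩
  toℕ (lookup (w [ q ]≔ lookup w j) q) ≡⟨ cong toℕ (lookup∘update q w (lookup w j)) ⟩
  toℕ (lookup w j)            ≡⟨ entry-lookup w j ⟨
  entry w (toℕ j)             ≡⟨ cong (entry w) (transpose-ˡ (toℕ q) (toℕ j)) ⟨
  entry w (transpose (toℕ q) (toℕ j) (toℕ q)) ∎
  where open ≡-Reasoning
... | no  q≢j  | no  q≢i  = begin
  toℕ (lookup (swap w i j) q) ≡⟨ cong toℕ (lookup∘update′ q≢j (w [ i ]≔ lookup w j) (lookup w i)) ⟩
  toℕ (lookup (w [ i ]≔ lookup w j) q) ≡⟨ cong toℕ (lookup∘update′ q≢i w (lookup w j)) ⟩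
  toℕ (lookup w q)            ≡⟨ entry-lookup w q ⟨
  entry w (toℕ q)             ≡⟨ cong (entry w) (transpose-other (q≢i ∘ toℕ-injective) (q≢j ∘ toℕ-injective)) ⟨
  entry w (transpose (toℕ i) (toℕ j) (toℕ q)) ∎
  where open ≡-Reasoning

entry-swap : (w : Word n) (i j : Fin n) → i ≢ j → p < n →
             entry (swap w i j) p ≡ entry w (transpose (toℕ i) (toℕ j) p)
entry-swap {n} {p} w i j i≢j p<n = begin
  entry (swap w i j) p                          ≡⟨ entry-fromℕ< (swap w i j) p<n ⟩
  toℕ (lookup (swap w i j) (fromℕ< p<n))        ≡⟨ lookup-swap w i j i≢j (fromℕ< p<n) ⟩
  entry w (transpose (toℕ i) (toℕ j) (toℕ (fromℕ< p<n))) ≡⟨ cong (entry w ∘ transpose (toℕ i) (toℕ j)) (toℕ-fromℕ< p<n) ⟩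
  entry w (transpose (toℕ i) (toℕ j) p)         ∎
  where open ≡-Reasoning

swap-isPerm : (w : Word n) (i j : Fin n) → i ≢ j → IsPerm w → IsPerm (swap w i j)
swap-isPerm w i j i≢j w-perm = injectiveBelow⇒isPerm (swap w i j) λ p<n q<n eq →
  injectiveBelow-transpose (toℕ<n i) (toℕ<n j) (i≢j ∘ toℕ-injective) (isPerm⇒injectiveBelow w w-perm) p<n q<n
    (trans (sym (entry-swap w i j i≢j p<n)) (trans eq (entry-swap w i j i≢j q<n)))

-- Inversions

inside : ℕ → ℕ → ℕ → ℕ
inside i j m = 𝟙 ((i <ᵇ m) ∧ (m <ᵇ j))

δ : ℕ → ℕ → ℕ
δ p a = 𝟙 (p ≡ᵇ a)

inside-split-above : i < j → q ≢ i → q ≢ j → 𝟙 (j <ᵇ q) + inside i j q ≡ 𝟙 (i <ᵇ q)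
inside-split-above {i} {j} {q} i<j q≢i q≢j with <-cmp q i
... | tri< q<i _ _ rewrite <ᵇ-false (<⇒≤ (<-trans q<i i<j)) | <ᵇ-false (<⇒≤ q<i) = refl
... | tri≈ _ q≡i _ = contradiction q≡i q≢i
... | tri> _ _ i<q with <-cmp q j
...   | tri< q<j _ _ rewrite <ᵇ-false (<⇒≤ q<j) | <ᵇ-true i<q | <ᵇ-true q<j = refl
...   | tri≈ _ q≡j _ = contradiction q≡j q≢j
...   | tri> _ _ j<q rewrite <ᵇ-true j<q | <ᵇ-true i<q | <ᵇ-false (<⇒≤ j<q) = refl

inside-split-below : i < j → p ≢ i → p ≢ j → 𝟙 (p <ᵇ j) ≡ 𝟙 (p <ᵇ i) + inside i j p
inside-split-below {i} {j} {p} i<j p≢i p≢j with <-cmp p i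
... | tri< p<i _ _ rewrite <ᵇ-true (<-trans p<i i<j) | <ᵇ-true p<i | <ᵇ-false (<⇒≤ p<i) = refl
... | tri≈ _ p≡i _ = contradiction p≡i p≢i
... | tri> _ _ i<p with <-cmp p j
...   | tri< p<j _ _ rewrite <ᵇ-false (<⇒≤ i<p) | <ᵇ-true i<p | <ᵇ-true p<j = refl
...   | tri≈ _ p≡j _ = contradiction p≡j p≢j
...   | tri> _ _ j<p rewrite <ᵇ-false (<⇒≤ j<p) | <ᵇ-false (<⇒≤ i<p) | <ᵇ-true i<p = refl

inside-* : ∀ {f g : ℕ → ℕ} → (∀ m → i < m → m < j → f m ≡ g m) → ∀ m → inside i j m * f m ≡ inside i j m * g m
inside-* {i} {j} eq m with i <ᵇ m in i<ᵇm | m <ᵇ j in m<ᵇj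
... | false | _     = refl
... | true  | false = refl
... | true  | true  = cong (1 *_) (eq m (<ᵇ-sound i<ᵇm) (<ᵇ-sound m<ᵇj))

𝟙-between-zero : ∀ {a b e} → (a < b → e ≤ b) → 𝟙 ((a <ᵇ b) ∧ (b <ᵇ e)) ≡ 0
𝟙-between-zero {a} {b} a<b⇒e≤b with a <? b
... | yes a<b rewrite <ᵇ-true a<b | <ᵇ-false (a<b⇒e≤b a<b) = refl
... | no  a≮b rewrite <ᵇ-false (≮⇒≥ a≮b) = refl

𝟙-between-one : ∀ {a b e} → a < b → b < e → 𝟙 ((a <ᵇ b) ∧ (b <ᵇ e)) ≡ 1
𝟙-between-one a<b b<e rewrite <ᵇ-true a<b | <ᵇ-true b<e = refl

data Position (i j : ℕ) : ℕ → Set where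
  at-i  : Position i j i
  at-j  : Position i j j
  other : ∀ {p} → p ≢ i → p ≢ j → Position i j p

position : ∀ i j p → Position i j p
position i j p with p ≟ i | p ≟ j
... | yes refl | _        = at-i
... | no  p≢i  | yes refl = at-j
... | no  p≢i  | no  p≢j  = other p≢i p≢j

-- Exchanging positions i < j reverses the order of exactly the pairs (i, j), (i, m), (m, j) with
-- i < m < j and of their mirror images; corner a b ι indicates (a, b), (a, m), (m, b) for ι m = 1.
corner : ℕ → ℕ → (ℕ → ℕ) → ℕ → ℕ → ℕ
corner a b ι p q = δ p a * δ q b + δ q b * ι p + δ p a * ι q

module _ {i j : ℕ} (i<j : i < j) where
  private
    i≢j : i ≢ j
    i≢j = <⇒≢ i<j
    j≢i : j ≢ i
    j≢i = i≢j ∘ sym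
    ii : (i <ᵇ i) ≡ false
    ii = <ᵇ-false (≤-refl {i})
    jj : (j <ᵇ j) ≡ false
    jj = <ᵇ-false (≤-refl {j})
    ji : (j <ᵇ i) ≡ false
    ji = <ᵇ-false (<⇒≤ i<j)
    split-above : q ≢ i → q ≢ j → 𝟙 (j <ᵇ q) + (inside i j q + 0) ≡ 𝟙 (i <ᵇ q) + 0
    split-above {q} q≢i q≢j = trans (cong (𝟙 (j <ᵇ q) +_) (+-identityʳ (inside i j q)))
                                    (trans (inside-split-above i<j q≢i q≢j) (sym (+-identityʳ (𝟙 (i <ᵇ q)))))
    split-below : p ≢ i → p ≢ j → 𝟙 (p <ᵇ j) + 0 ≡ 𝟙 (p <ᵇ i) + (inside i j p + 0 + 0)
    split-below {p} p≢i p≢j = trans (+-identityʳ (𝟙 (p <ᵇ j))) (trans (inside-split-below i<j p≢i p≢j)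
                                    (cong (𝟙 (p <ᵇ i) +_) (sym (trans (+-identityʳ _) (+-identityʳ (inside i j p))))))

  transpose-<ᵇ : ∀ p q →
    𝟙 (transpose i j p <ᵇ transpose i j q) + corner i j (inside i j) p q ≡ 𝟙 (p <ᵇ q) + corner j i (inside i j) p q
  transpose-<ᵇ p q with position i j p | position i j q
  ... | at-i | at-i rewrite ≡ᵇ-refl i | ≡ᵇ-false i≢j | ii | jj = refl
  ... | at-i | at-j rewrite ≡ᵇ-refl i | ≡ᵇ-refl j | ≡ᵇ-false i≢j | ≡ᵇ-false j≢i | <ᵇ-true i<j | ji | ii | jj = refl
  ... | at-j | at-i rewrite ≡ᵇ-refl i | ≡ᵇ-refl j | ≡ᵇ-false i≢j | ≡ᵇ-false j≢i | <ᵇ-true i<j | ji | ii | jj = refl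
  ... | at-j | at-j rewrite ≡ᵇ-refl j | ≡ᵇ-false j≢i | ii | jj | ∧-zeroʳ (i <ᵇ j) = refl
  ... | at-i | other q≢i q≢j rewrite ≡ᵇ-refl i | ≡ᵇ-false i≢j | ≡ᵇ-false q≢i | ≡ᵇ-false q≢j = split-above q≢i q≢j
  ... | at-j | other q≢i q≢j rewrite ≡ᵇ-refl j | ≡ᵇ-false j≢i | ≡ᵇ-false q≢i | ≡ᵇ-false q≢j = sym (split-above q≢i q≢j)
  ... | other p≢i p≢j | at-i rewrite ≡ᵇ-refl i | ≡ᵇ-false i≢j | ≡ᵇ-false p≢i | ≡ᵇ-false p≢j = split-below p≢i p≢j
  ... | other p≢i p≢j | at-j rewrite ≡ᵇ-refl j | ≡ᵇ-false j≢i | ≡ᵇ-false p≢i | ≡ᵇ-false p≢j = sym (split-below p≢i p≢j)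
  ... | other p≢i p≢j | other q≢i q≢j rewrite ≡ᵇ-false p≢i | ≡ᵇ-false p≢j | ≡ᵇ-false q≢i | ≡ᵇ-false q≢j
    = refl

∑-δ : ∀ k (f : ℕ → ℕ) → p < k → ∑[ q < k ] (δ q p * f q) ≡ f p
∑-δ {p} k f p<k = begin
  ∑ k δf              ≡⟨ +-identityʳ (∑ k δf) ⟨
  ∑ k δf + 0          ≡⟨ ∑-update {g = δf} {h = λ _ → 0} k p<k (λ q _ q≢p → cong (λ b → 𝟙 b * f q) (≡ᵇ-false q≢p)) ⟩
  ∑[ q < k ] 0 + δf p ≡⟨ cong₂ _+_ (∑-zero k λ _ _ → refl) (cong (λ b → 𝟙 b * f p) (≡ᵇ-refl p)) ⟩
  f p + 0             ≡⟨ +-identityʳ (f p) ⟩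
  f p                 ∎
  where
  open ≡-Reasoning
  δf : ℕ → ℕ
  δf q = δ q p * f q

∑-distrib-+₃ : ∀ {f} k → ∑[ p < k ] (f p + g p + h p) ≡ ∑ k f + ∑ k g + ∑ k h
∑-distrib-+₃ {g} {h} {f} k = trans (∑-distrib-+ {λ p → f p + g p} {h} k) (cong (_+ ∑ k h) (∑-distrib-+ k))

∑∑-corner : ∀ n (ι : ℕ → ℕ) (c : ℕ → ℕ → ℕ) → i < n → j < n →
  ∑[ p < n ] ∑[ q < n ] (corner i j ι p q * c p q) ≡ c i j + ∑[ m < n ] (ι m * c m j) + ∑[ m < n ] (ι m * c i m)
∑∑-corner {i} {j} n ι c i<n j<n = begin
  ∑[ p < n ] ∑[ q < n ] (corner i j ι p q * c p q)
    ≡⟨ ∑-cong n (λ p _ → trans (∑-cong n λ q _ → expand (δ p i) (δ q j) (ι p) (ι q) (c p q)) (row p)) ⟩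
  ∑[ p < n ] (δ p i * c p j + ι p * c p j + δ p i * ∑[ q < n ] (ι q * c p q))
    ≡⟨ ∑-distrib-+₃ n ⟩
  ∑[ p < n ] (δ p i * c p j) + ∑[ p < n ] (ι p * c p j) + ∑[ p < n ] (δ p i * ∑[ q < n ] (ι q * c p q))
    ≡⟨ cong₂ _+_ (cong (_+ ∑[ p < n ] (ι p * c p j)) (∑-δ n (λ p → c p j) i<n)) (∑-δ n (λ p → ∑[ q < n ] (ι q * c p q)) i<n) ⟩
  c i j + ∑[ m < n ] (ι m * c m j) + ∑[ m < n ] (ι m * c i m) ∎
  where
  open ≡-Reasoning
  expand : ∀ a b x y z → (a * b + b * x + a * y) * z ≡ b * (a * z) + b * (x * z) + a * (y * z)
  expand = solve-∀
  row : ∀ p → ∑[ q < n ] (δ q j * (δ p i * c p q) + δ q j * (ι p * c p q) + δ p i * (ι q * c p q))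
            ≡ δ p i * c p j + ι p * c p j + δ p i * ∑[ q < n ] (ι q * c p q)
  row p = trans (∑-distrib-+₃ n) (cong₂ _+_ (cong₂ _+_ (∑-δ n (λ q → δ p i * c p q) j<n) (∑-δ n (λ q → ι p * c p q) j<n))
                                            (∑-distribˡ-* (δ p i) n))

∑∑-transpose : i < j → j < n → (c : ℕ → ℕ → ℕ) →
  let τ = transpose i j; ι = inside i j in
  ∑[ p < n ] ∑[ q < n ] (𝟙 (p <ᵇ q) * c (τ p) (τ q)) + (c i j + ∑[ m < n ] (ι m * c m j) + ∑[ m < n ] (ι m * c i m))
    ≡ ∑[ p < n ] ∑[ q < n ] (𝟙 (p <ᵇ q) * c p q) + (c j i + ∑[ m < n ] (ι m * c m i) + ∑[ m < n ] (ι m * c j m))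
∑∑-transpose {i} {j} {n} i<j j<n c = begin
  ∑[ p < n ] ∑[ q < n ] (𝟙 (p <ᵇ q) * c (τ p) (τ q)) + (c i j + ∑[ m < n ] (ι m * c m j) + ∑[ m < n ] (ι m * c i m))
    ≡⟨ cong₂ _+_ reindex (∑∑-corner n ι c i<n j<n) ⟨
  ∑[ p < n ] ∑[ q < n ] (𝟙 (τ p <ᵇ τ q) * c p q) + ∑[ p < n ] ∑[ q < n ] (corner i j ι p q * c p q)
    ≡⟨ ∑∑-+ {λ p q → 𝟙 (τ p <ᵇ τ q)} {corner i j ι} ⟨
  ∑[ p < n ] ∑[ q < n ] ((𝟙 (τ p <ᵇ τ q) + corner i j ι p q) * c p q)
    ≡⟨ ∑-cong n (λ p _ → ∑-cong n λ q _ → cong (_* c p q) (transpose-<ᵇ i<j p q)) ⟩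
  ∑[ p < n ] ∑[ q < n ] ((𝟙 (p <ᵇ q) + corner j i ι p q) * c p q)
    ≡⟨ ∑∑-+ {λ p q → 𝟙 (p <ᵇ q)} {corner j i ι} ⟩
  ∑[ p < n ] ∑[ q < n ] (𝟙 (p <ᵇ q) * c p q) + ∑[ p < n ] ∑[ q < n ] (corner j i ι p q * c p q)
    ≡⟨ cong (∑[ p < n ] ∑[ q < n ] (𝟙 (p <ᵇ q) * c p q) +_) (∑∑-corner n ι c j<n i<n) ⟩
  ∑[ p < n ] ∑[ q < n ] (𝟙 (p <ᵇ q) * c p q) + (c j i + ∑[ m < n ] (ι m * c m i) + ∑[ m < n ] (ι m * c j m)) ∎
  where
  open ≡-Reasoning
  τ : ℕ → ℕ
  τ = transpose i j
  ι : ℕ → ℕ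
  ι = inside i j
  i<n : i < n
  i<n = <-trans i<j j<n
  ∑∑-+ : ∀ {a b : ℕ → ℕ → ℕ} → ∑[ p < n ] ∑[ q < n ] ((a p q + b p q) * c p q)
                               ≡ ∑[ p < n ] ∑[ q < n ] (a p q * c p q) + ∑[ p < n ] ∑[ q < n ] (b p q * c p q)
  ∑∑-+ {a} {b} = trans (∑-cong n λ p _ → trans (∑-cong n λ q _ → *-distribʳ-+ (c p q) (a p q) (b p q)) (∑-distrib-+ n))
                       (∑-distrib-+ n)
  reindex : ∑[ p < n ] ∑[ q < n ] (𝟙 (τ p <ᵇ τ q) * c p q) ≡ ∑[ p < n ] ∑[ q < n ] (𝟙 (p <ᵇ q) * c (τ p) (τ q))
  reindex = trans (sym (∑-transpose i<n j<n (<⇒≢ i<j)))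
                  (∑-cong n λ p _ → trans (sym (∑-transpose i<n j<n (<⇒≢ i<j)))
                                          (∑-cong n λ q _ → cong₂ (λ p′ q′ → 𝟙 (p′ <ᵇ q′) * c (τ p) (τ q))
                                                                  (transpose-involutive (<⇒≢ i<j) p)
                                                                  (transpose-involutive (<⇒≢ i<j) q)))

inversions : ℕ → (ℕ → ℕ) → ℕ
inversions n W = ∑[ p < n ] ∑[ q < n ] (𝟙 (p <ᵇ q) * 𝟙 (W q <ᵇ W p))

𝟙-between : i < j → x ≢ i → x ≢ j →
  𝟙 (i <ᵇ x) + 𝟙 (x <ᵇ j) ≡ 𝟙 (j <ᵇ x) + 𝟙 (x <ᵇ i) + 2 * 𝟙 ((i <ᵇ x) ∧ (x <ᵇ j))
𝟙-between {i} {j} {x} i<j x≢i x≢j with <-cmp x i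
... | tri< x<i _ _ rewrite <ᵇ-false (<⇒≤ x<i) | <ᵇ-true (<-trans x<i i<j) | <ᵇ-false (<⇒≤ (<-trans x<i i<j)) | <ᵇ-true x<i = refl
... | tri≈ _ x≡i _ = contradiction x≡i x≢i
... | tri> _ _ i<x with <-cmp x j
...   | tri< x<j _ _ rewrite <ᵇ-true i<x | <ᵇ-true x<j | <ᵇ-false (<⇒≤ x<j) | <ᵇ-false (<⇒≤ i<x) = refl
...   | tri≈ _ x≡j _ = contradiction x≡j x≢j
...   | tri> _ _ j<x rewrite <ᵇ-true i<x | <ᵇ-false (<⇒≤ j<x) | <ᵇ-true j<x | <ᵇ-false (<⇒≤ i<x) = refl

∑-inside-comparisons : ∀ {W : ℕ → ℕ} → W i < W j → (∀ m → i < m → m < j → W m ≢ W i × W m ≢ W j) →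
  ∑[ m < n ] (inside i j m * 𝟙 (W i <ᵇ W m)) + ∑[ m < n ] (inside i j m * 𝟙 (W m <ᵇ W j))
    ≡ ∑[ m < n ] (inside i j m * 𝟙 (W j <ᵇ W m)) + ∑[ m < n ] (inside i j m * 𝟙 (W m <ᵇ W i))
      + 2 * ∑[ m < n ] (inside i j m * 𝟙 ((W i <ᵇ W m) ∧ (W m <ᵇ W j)))
∑-inside-comparisons {i} {j} {n} {W} Wi<Wj distinct = begin
  ∑[ m < n ] (ι m * 𝟙 (W i <ᵇ W m)) + ∑[ m < n ] (ι m * 𝟙 (W m <ᵇ W j))
    ≡⟨ ∑-distrib-+ n ⟨
  ∑[ m < n ] (ι m * 𝟙 (W i <ᵇ W m) + ι m * 𝟙 (W m <ᵇ W j))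
    ≡⟨ ∑-cong n (λ m _ → pointwise m) ⟩
  ∑[ m < n ] (ι m * 𝟙 (W j <ᵇ W m) + ι m * 𝟙 (W m <ᵇ W i) + 2 * (ι m * between m))
    ≡⟨ ∑-distrib-+₃ n ⟩
  ∑[ m < n ] (ι m * 𝟙 (W j <ᵇ W m)) + ∑[ m < n ] (ι m * 𝟙 (W m <ᵇ W i)) + ∑[ m < n ] (2 * (ι m * between m))
    ≡⟨ cong (∑[ m < n ] (ι m * 𝟙 (W j <ᵇ W m)) + ∑[ m < n ] (ι m * 𝟙 (W m <ᵇ W i)) +_) (∑-distribˡ-* 2 n) ⟩
  ∑[ m < n ] (ι m * 𝟙 (W j <ᵇ W m)) + ∑[ m < n ] (ι m * 𝟙 (W m <ᵇ W i)) + 2 * ∑[ m < n ] (ι m * between m) ∎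
  where
  open ≡-Reasoning
  ι between : ℕ → ℕ
  ι = inside i j
  between m = 𝟙 ((W i <ᵇ W m) ∧ (W m <ᵇ W j))
  distrib₃ : ∀ t a b c → t * (a + b + 2 * c) ≡ t * a + t * b + 2 * (t * c)
  distrib₃ = solve-∀
  pointwise : ∀ m → ι m * 𝟙 (W i <ᵇ W m) + ι m * 𝟙 (W m <ᵇ W j)
                  ≡ ι m * 𝟙 (W j <ᵇ W m) + ι m * 𝟙 (W m <ᵇ W i) + 2 * (ι m * between m)
  pointwise m = begin
    ι m * 𝟙 (W i <ᵇ W m) + ι m * 𝟙 (W m <ᵇ W j)          ≡⟨ *-distribˡ-+ (ι m) _ _ ⟨
    ι m * (𝟙 (W i <ᵇ W m) + 𝟙 (W m <ᵇ W j))              ≡⟨ inside-* {f = λ m → 𝟙 (W i <ᵇ W m) + 𝟙 (W m <ᵇ W j)}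
                                                              (λ m i<m m<j → uncurry (𝟙-between Wi<Wj) (distinct m i<m m<j)) m ⟩
    ι m * (𝟙 (W j <ᵇ W m) + 𝟙 (W m <ᵇ W i) + 2 * between m) ≡⟨ distrib₃ (ι m) _ _ _ ⟩
    ι m * 𝟙 (W j <ᵇ W m) + ι m * 𝟙 (W m <ᵇ W i) + 2 * (ι m * between m) ∎

inversions-transpose : ∀ {W : ℕ → ℕ} → i < j → j < n → W i < W j → (∀ m → i < m → m < j → W m ≢ W i × W m ≢ W j) →
  inversions n (W ∘ transpose i j)
    ≡ suc (inversions n W + 2 * ∑[ m < n ] (inside i j m * 𝟙 ((W i <ᵇ W m) ∧ (W m <ᵇ W j))))
inversions-transpose {i} {j} {n} {W} i<j j<n Wi<Wj distinct = +-cancelʳ-≡ (A₁ + A₂) _ _ $ begin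
  inversions n (W ∘ transpose i j) + (A₁ + A₂)         ≡⟨ cong (λ b → inversions n (W ∘ transpose i j) + (𝟙 b + A₁ + A₂))
                                                             (<ᵇ-false (<⇒≤ Wi<Wj)) ⟨
  inversions n (W ∘ transpose i j) + (c i j + A₁ + A₂) ≡⟨ ∑∑-transpose i<j j<n c ⟩
  inversions n W + (c j i + B₁ + B₂)                   ≡⟨ cong (λ b → inversions n W + (𝟙 b + B₁ + B₂)) (<ᵇ-true Wi<Wj) ⟩
  inversions n W + (1 + B₁ + B₂)                       ≡⟨ cong (inversions n W +_) (+-assoc 1 B₁ B₂) ⟩
  inversions n W + suc (B₁ + B₂)                       ≡⟨ cong (λ b → inversions n W + suc b)
                                                             (∑-inside-comparisons {n = n} {W = W} Wi<Wj distinct) ⟩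
  inversions n W + suc (A₁ + A₂ + 2 * K)               ≡⟨ rearrange (inversions n W) (A₁ + A₂) K ⟩
  suc (inversions n W + 2 * K) + (A₁ + A₂)             ∎
  where
  open ≡-Reasoning
  c : ℕ → ℕ → ℕ
  c p q = 𝟙 (W q <ᵇ W p)
  A₁ A₂ B₁ B₂ K : ℕ
  A₁ = ∑[ m < n ] (inside i j m * c m j)
  A₂ = ∑[ m < n ] (inside i j m * c i m)
  B₁ = ∑[ m < n ] (inside i j m * c m i)
  B₂ = ∑[ m < n ] (inside i j m * c j m)
  K  = ∑[ m < n ] (inside i j m * 𝟙 ((W i <ᵇ W m) ∧ (W m <ᵇ W j)))
  rearrange : ∀ x a k → x + suc (a + 2 * k) ≡ suc (x + 2 * k) + a
  rearrange = solve-∀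

inversions-cong : ∀ {W W′ : ℕ → ℕ} → (∀ p → p < n → W p ≡ W′ p) → inversions n W ≡ inversions n W′
inversions-cong {n} eq = ∑-cong n λ p p<n → ∑-cong n λ q q<n →
  cong₂ (λ a b → 𝟙 (p <ᵇ q) * 𝟙 (a <ᵇ b)) (eq q q<n) (eq p p<n)

injective⇒distinct : ∀ {W : ℕ → ℕ} → InjectiveBelow n W → j < n → ∀ m → i < m → m < j → W m ≢ W i × W m ≢ W j
injective⇒distinct inj j<n m i<m m<j =
  (λ Wm≡Wi → <⇒≢ i<m (sym (inj (<-trans m<j j<n) (<-trans (<-trans i<m m<j) j<n) Wm≡Wi))) ,
  (λ Wm≡Wj → <⇒≢ m<j (inj (<-trans m<j j<n) j<n Wm≡Wj))

inversions-transpose-descent : ∀ {W : ℕ → ℕ} → i < j → j < n → InjectiveBelow n W → W j < W i →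
  inversions n W ≡ suc (inversions n (W ∘ transpose i j) + 2 * ∑[ m < n ] (inside i j m * 𝟙 ((W j <ᵇ W m) ∧ (W m <ᵇ W i))))
inversions-transpose-descent {i} {j} {n} {W} i<j j<n inj Wj<Wi = begin
  inversions n W                    ≡⟨ inversions-cong {n} (λ p _ → cong W (transpose-involutive i≢j p)) ⟨
  inversions n (W′ ∘ transpose i j) ≡⟨ inversions-transpose i<j j<n W′i<W′j (injective⇒distinct W′-inj j<n) ⟩
  suc (inversions n W′ + 2 * ∑[ m < n ] (inside i j m * 𝟙 ((W′ i <ᵇ W′ m) ∧ (W′ m <ᵇ W′ j))))
    ≡⟨ cong (λ K → suc (inversions n W′ + 2 * K)) (∑-cong n λ m _ → inside-* unmoved m) ⟩
  suc (inversions n W′ + 2 * ∑[ m < n ] (inside i j m * 𝟙 ((W j <ᵇ W m) ∧ (W m <ᵇ W i)))) ∎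
  where
  open ≡-Reasoning
  i≢j : i ≢ j
  i≢j = <⇒≢ i<j
  W′ : ℕ → ℕ
  W′ = W ∘ transpose i j
  W′-inj : InjectiveBelow n W′
  W′-inj = injectiveBelow-transpose (<-trans i<j j<n) j<n i≢j inj
  W′i<W′j : W′ i < W′ j
  W′i<W′j = subst₂ _<_ (cong W (sym (transpose-ˡ i j))) (cong W (sym (transpose-ʳ i≢j))) Wj<Wi
  unmoved : ∀ m → i < m → m < j → 𝟙 ((W′ i <ᵇ W′ m) ∧ (W′ m <ᵇ W′ j)) ≡ 𝟙 ((W j <ᵇ W m) ∧ (W m <ᵇ W i))
  unmoved m i<m m<j rewrite transpose-ˡ i j | transpose-ʳ i≢j | transpose-other (≢-sym (<⇒≢ i<m)) (<⇒≢ m<j) = refl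

sum-tabulate : (g : ℕ → ℕ) {f : Fin n → ℕ} → (∀ i → f i ≡ g (toℕ i)) → sum (L.tabulate f) ≡ ∑ n g
sum-tabulate {zero}  g eq = refl
sum-tabulate {suc n} g eq = trans (cong₂ _+_ (eq F.zero) (sum-tabulate (g ∘ suc) (eq ∘ F.suc))) (sym (∑-suc n))

sum-map-allFin : (g : ℕ → ℕ) {f : Fin n → ℕ} → (∀ i → f i ≡ g (toℕ i)) → sum (L.map f (L.allFin n)) ≡ ∑ n g
sum-map-allFin g {f} eq = trans (cong sum (map-tabulate id f)) (sum-tabulate g eq)

inv≡inversions : (w : Word n) → inv w ≡ inversions n (entry w)
inv≡inversions {n} w =
  sum-map-allFin (λ p → ∑[ q < n ] (𝟙 (p <ᵇ q) * 𝟙 (W q <ᵇ W p))) λ i →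
  sum-map-allFin (λ q → 𝟙 (toℕ i <ᵇ q) * 𝟙 (W q <ᵇ W (toℕ i))) λ j →
  trans (𝟙-∧ (toℕ i <ᵇ toℕ j) _) (cong₂ (λ a b → 𝟙 (toℕ i <ᵇ toℕ j) * 𝟙 (a <ᵇ b)) (sym (entry-lookup w j)) (sym (entry-lookup w i)))
  where
  W : ℕ → ℕ
  W = entry w

-- Heights and depths of lattice paths

⊖-+-⊖ : ∀ a b c d → (a ⊖ b) ℤ.+ (c ⊖ d) ≡ (a + c) ⊖ (b + d)
⊖-+-⊖ a b c d = begin
  (a ⊖ b) ℤ.+ (c ⊖ d)                     ≡⟨ cong₂ ℤ._+_ ([+m]-[+n]≡m⊖n a b) ([+m]-[+n]≡m⊖n c d) ⟨
  (pos a ℤ.- pos b) ℤ.+ (pos c ℤ.- pos d) ≡⟨ ℤ-interchange (pos a) (pos b) (pos c) (pos d) ⟩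
  (pos a ℤ.+ pos c) ℤ.- (pos b ℤ.+ pos d) ≡⟨ cong₂ ℤ._-_ (pos-+ a c) (pos-+ b d) ⟨
  pos (a + c) ℤ.- pos (b + d)             ≡⟨ [+m]-[+n]≡m⊖n (a + c) (b + d) ⟩
  (a + c) ⊖ (b + d)                       ∎
  where
  open ≡-Reasoning
  ℤ-interchange : ∀ a b c d → (a ℤ.- b) ℤ.+ (c ℤ.- d) ≡ (a ℤ.+ c) ℤ.- (b ℤ.+ d)
  ℤ-interchange = ℤ-solve-∀

foldr-tabulate-⊖ : (a b : ℕ → ℕ) {f : Fin n → ℤ} → (∀ i → f i ≡ a (toℕ i) ⊖ b (toℕ i)) →
                   foldr ℤ._+_ (pos 0) (L.tabulate f) ≡ ∑ n a ⊖ ∑ n b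
foldr-tabulate-⊖ {zero}  a b eq = refl
foldr-tabulate-⊖ {suc n} a b eq = begin
  _ ≡⟨ cong₂ ℤ._+_ (eq F.zero) (foldr-tabulate-⊖ (a ∘ suc) (b ∘ suc) (eq ∘ F.suc)) ⟩
  (a 0 ⊖ b 0) ℤ.+ (∑[ p < n ] a (suc p) ⊖ ∑[ p < n ] b (suc p)) ≡⟨ ⊖-+-⊖ (a 0) (b 0) _ _ ⟩
  (a 0 + ∑[ p < n ] a (suc p)) ⊖ (b 0 + ∑[ p < n ] b (suc p))   ≡⟨ cong₂ _⊖_ (∑-suc n) (∑-suc n) ⟨
  ∑ (suc n) a ⊖ ∑ (suc n) b ∎
  where open ≡-Reasoning

negPart-⊖ : ∀ a b → negPart (a ⊖ b) ≡ b ∸ a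
negPart-⊖ a b with a <? b
... | yes a<b rewrite ⊖-< a<b = negPart-neg (b ∸ a)
  where
  negPart-neg : ∀ m → negPart (ℤ.- pos m) ≡ m
  negPart-neg zero    = refl
  negPart-neg (suc m) = refl
... | no  a≮b rewrite ⊖-≥ (≮⇒≥ a≮b) = sym (m≤n⇒m∸n≡0 (≮⇒≥ a≮b))

any< : ℕ → (ℕ → Bool) → Bool
any< zero    b = false
any< (suc k) b = any< k b ∨ b k

any<-suc : ∀ k (b : ℕ → Bool) → any< (suc k) b ≡ b 0 ∨ any< k (b ∘ suc)
any<-suc zero    b = ∨-comm false (b 0)
any<-suc (suc k) b = trans (cong (_∨ b (suc k)) (any<-suc k b)) (∨-assoc (b 0) _ _)

any<-cong : ∀ k {b c : ℕ → Bool} → (∀ p → p < k → b p ≡ c p) → any< k b ≡ any< k c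
any<-cong zero    eq = refl
any<-cong (suc k) eq = cong₂ _∨_ (any<-cong k λ p p<k → eq p (m<n⇒m<1+n p<k)) (eq k ≤-refl)

any<-false : ∀ k {b : ℕ → Bool} → (∀ p → p < k → b p ≡ false) → any< k b ≡ false
any<-false zero    eq = refl
any<-false (suc k) eq = cong₂ _∨_ (any<-false k λ p p<k → eq p (m<n⇒m<1+n p<k)) (eq k ≤-refl)

any<-guard : ∀ {b : ℕ → Bool} → k ≤ n → any< n (λ p → (p <ᵇ k) ∧ b p) ≡ any< k b
any<-guard {n = zero}  z≤n = refl
any<-guard {k} {suc n} {b} k≤1+n with m≤n⇒m<n∨m≡n k≤1+n
... | inj₁ k≤n rewrite any<-guard {b = b} (≤-pred k≤n) | <ᵇ-false (≤-pred k≤n) = ∨-identityʳ (any< k b)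
... | inj₂ refl rewrite <ᵇ-true (≤-refl {suc n}) =
  cong (_∨ b n) (any<-cong n λ p p<n → cong (_∧ b p) (<ᵇ-true (m<n⇒m<1+n p<n)))

or-tabulate : (b : ℕ → Bool) {f : Fin n → Bool} → (∀ i → f i ≡ b (toℕ i)) → or (L.tabulate f) ≡ any< n b
or-tabulate {zero}  b eq = refl
or-tabulate {suc n} b eq = trans (cong₂ _∨_ (eq F.zero) (or-tabulate (b ∘ suc) (eq ∘ F.suc))) (sym (any<-suc n b))

prefixCount : (ℕ → ℕ) → ℕ → ℕ → ℕ
prefixCount W k x = ∑[ p < k ] 𝟙 (W p <ᵇ x)

prefixCount-zero : ∀ W k → prefixCount W k 0 ≡ 0
prefixCount-zero W k = ∑-zero k λ p _ → 𝟙-<-false {0} {W p} z≤n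

prefixCount-cong : ∀ {W W′ : ℕ → ℕ} → (∀ p → p < k → W p ≡ W′ p) → prefixCount W k x ≡ prefixCount W′ k x
prefixCount-cong {k} {x} eq = ∑-cong k λ p p<k → cong (λ y → 𝟙 (y <ᵇ x)) (eq p p<k)

⌊≟⌋≡≡ᵇ : (a b : Fin n) → ⌊ a F.≟ b ⌋ ≡ (toℕ a ≡ᵇ toℕ b)
⌊≟⌋≡≡ᵇ a b with a F.≟ b
... | yes refl = sym (≡ᵇ-refl (toℕ a))
... | no  a≢b  = sym (≡ᵇ-false (a≢b ∘ toℕ-injective))

prefixSet≡any< : (w : Word n) → k ≤ n → ∀ y → prefixSet w k y ≡ any< k (λ p → entry w p ≡ᵇ toℕ y)
prefixSet≡any< {n} {k} w k≤n y = begin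
  prefixSet w k y                                ≡⟨ cong or (map-tabulate id member) ⟩
  or (L.tabulate member)                         ≡⟨ or-tabulate _ (λ p → cong ((toℕ p <ᵇ k) ∧_) (same-value p)) ⟩
  any< n (λ p → (p <ᵇ k) ∧ (entry w p ≡ᵇ toℕ y)) ≡⟨ any<-guard k≤n ⟩
  any< k (λ p → entry w p ≡ᵇ toℕ y)              ∎
  where
  open ≡-Reasoning
  member : Fin n → Bool
  member p = (toℕ p <ᵇ k) ∧ ⌊ lookup w p F.≟ y ⌋
  same-value : ∀ p → ⌊ lookup w p F.≟ y ⌋ ≡ (entry w (toℕ p) ≡ᵇ toℕ y)
  same-value p = trans (⌊≟⌋≡≡ᵇ (lookup w p) y) (cong (_≡ᵇ toℕ y) (sym (entry-lookup w p)))

values-below≡prefixCount : ∀ {W : ℕ → ℕ} → InjectiveBelow n W → (∀ p → p < n → W p < n) → k ≤ n →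
  ∑[ y < n ] 𝟙 ((y <ᵇ x) ∧ any< k (λ p → W p ≡ᵇ y)) ≡ prefixCount W k x
values-below≡prefixCount {n} {zero}  {x} inj W<n _ = ∑-zero n λ y _ → cong 𝟙 (∧-zeroʳ (y <ᵇ x))
values-below≡prefixCount {n} {suc k} {x} {W} inj W<n k<n = begin
  ∑ n new                                ≡⟨ +-identityʳ (∑ n new) ⟨
  ∑ n new + 0                            ≡⟨ cong (∑ n new +_) old-at-Wk ⟨
  ∑ n new + old (W k)                    ≡⟨ ∑-update n (W<n k k<n) agree ⟩
  ∑ n old + new (W k)                    ≡⟨ cong₂ _+_ (values-below≡prefixCount {x = x} inj W<n (<⇒≤ k<n)) new-at-Wk ⟩
  prefixCount W k x + (𝟙 (W k <ᵇ x) + 0) ≡⟨ cong (prefixCount W k x +_) (+-identityʳ _) ⟩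
  prefixCount W (suc k) x                ∎
  where
  open ≡-Reasoning
  old new : ℕ → ℕ
  old y = 𝟙 ((y <ᵇ x) ∧ any< k (λ p → W p ≡ᵇ y))
  new y = 𝟙 ((y <ᵇ x) ∧ any< (suc k) (λ p → W p ≡ᵇ y))
  agree : ∀ y → y < n → y ≢ W k → new y ≡ old y
  agree y _ y≢Wk rewrite ≡ᵇ-false (y≢Wk ∘ sym) = cong (λ b → 𝟙 ((y <ᵇ x) ∧ b)) (∨-identityʳ _)
  old-at-Wk : old (W k) ≡ 0
  old-at-Wk rewrite any<-false k (λ p p<k → ≡ᵇ-false λ Wp≡Wk → <⇒≢ p<k (inj (<-trans p<k k<n) k<n Wp≡Wk)) =
    cong 𝟙 (∧-zeroʳ _)
  new-at-Wk : new (W k) ≡ 𝟙 (W k <ᵇ x) + 0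
  new-at-Wk rewrite ≡ᵇ-refl (W k) | ∨-zeroʳ (any< k (λ p → W p ≡ᵇ W k)) | ∧-identityʳ (W k <ᵇ x) = sym (+-identityʳ _)

restricted-step : (A B : Fin n → Bool) (x : ℕ) (y : Fin n) →
  (if toℕ y <ᵇ x then step A B y else pos 0) ≡ 𝟙 ((toℕ y <ᵇ x) ∧ A y) ⊖ 𝟙 ((toℕ y <ᵇ x) ∧ B y)
restricted-step A B x y with toℕ y <ᵇ x | A y | B y
... | false | _     | _     = refl
... | true  | true  | true  = refl
... | true  | true  | false = refl
... | true  | false | true  = refl
... | true  | false | false = refl

negPart-height : (u v : Word n) → IsPerm u → IsPerm v → k ≤ n → ∀ x →
  negPart (height (prefixSet u k) (prefixSet v k) x) ≡ prefixCount (entry v) k x ∸ prefixCount (entry u) k x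
negPart-height {n} {k} u v u-perm v-perm k≤n x = begin
  negPart (height U V x)                  ≡⟨ cong negPart (trans (cong (foldr ℤ._+_ (pos 0)) (map-tabulate id restrictedStep))
                                               (foldr-tabulate-⊖ (values u) (values v) restricted)) ⟩
  negPart (∑ n (values u) ⊖ ∑ n (values v)) ≡⟨ negPart-⊖ (∑ n (values u)) (∑ n (values v)) ⟩
  ∑ n (values v) ∸ ∑ n (values u)         ≡⟨ cong₂ _∸_ (count v v-perm) (count u u-perm) ⟩
  prefixCount (entry v) k x ∸ prefixCount (entry u) k x ∎
  where
  open ≡-Reasoning
  U V : Fin n → Bool
  U = prefixSet u k
  V = prefixSet v k
  values : Word n → ℕ → ℕ
  values w y = 𝟙 ((y <ᵇ x) ∧ any< k (λ p → entry w p ≡ᵇ y))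
  restrictedStep : Fin n → ℤ
  restrictedStep y = if toℕ y <ᵇ x then step U V y else pos 0
  restricted : ∀ y → restrictedStep y ≡ values u (toℕ y) ⊖ values v (toℕ y)
  restricted y = trans (restricted-step U V x y)
    (cong₂ (λ a b → 𝟙 ((toℕ y <ᵇ x) ∧ a) ⊖ 𝟙 ((toℕ y <ᵇ x) ∧ b)) (prefixSet≡any< u k≤n y) (prefixSet≡any< v k≤n y))
  count : (w : Word n) → IsPerm w → ∑ n (values w) ≡ prefixCount (entry w) k x
  count w w-perm = values-below≡prefixCount {x = x} (isPerm⇒injectiveBelow w w-perm) (λ p → entry-< w) k≤n

≤-foldr-⊔ : ∀ {xs} → x ∈ xs → x ≤ foldr _⊔_ 0 xs
≤-foldr-⊔ (here refl)                 = m≤m⊔n _ _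
≤-foldr-⊔ {xs = y ∷ _} (there x∈xs) = m≤n⇒m≤o⊔n y (≤-foldr-⊔ x∈xs)

depth-lub : ∀ (A B : Fin n → Bool) {c} → (∀ x → x ≤ n → negPart (height A B x) ≤ c) → depth A B ≤ c
depth-lub {n} A B {c} bounded = foldr-preservesᵇ {P = _≤ c} ⊔-lub z≤n
  (All.map⁺ (applyUpTo⁺₁ id (suc n) λ x<1+n → bounded _ (≤-pred x<1+n)))

≤-depth : ∀ (A B : Fin n → Bool) → x ≤ n → negPart (height A B x) ≤ depth A B
≤-depth A B x≤n = ≤-foldr-⊔ (∈-map⁺ (negPart ∘ height A B) (∈-upTo⁺ (s≤s x≤n)))

-- Edges and paths of Γ_n

data Region (i j k : ℕ) : Set where
  before  : k ≤ i → Region i j k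
  between : i < k → k ≤ j → Region i j k
  after   : j < k → Region i j k

region : ∀ i j k → Region i j k
region i j k with k ≤? i | j <? k
... | yes k≤i | _       = before k≤i
... | no  k≰i | yes j<k = after j<k
... | no  k≰i | no  j≮k = between (≰⇒> k≰i) (≮⇒≥ j≮k)

inside-before : ∀ j → k ≤ i → inside i j k ≡ 0
inside-before {k} {i} j k≤i rewrite <ᵇ-false k≤i = refl

inside-after : ∀ i → j < k → inside i (suc j) k ≡ 0
inside-after {j} {k} i j<k rewrite <ᵇ-false {suc j} {k} j<k = cong 𝟙 (∧-zeroʳ (i <ᵇ k))

inside-between : i < k → k ≤ j → inside i (suc j) k ≡ 1
inside-between i<k k≤j rewrite <ᵇ-true i<k | <ᵇ-true (s≤s k≤j) = refl

prefixCount-transpose-before : ∀ {W : ℕ → ℕ} → i < j → k ≤ i → prefixCount (W ∘ transpose i j) k x ≡ prefixCount W k x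
prefixCount-transpose-before {x = x} {W} i<j k≤i = prefixCount-cong {x = x} λ p p<k →
  cong W (transpose-other (<⇒≢ (<-≤-trans p<k k≤i)) (<⇒≢ (<-trans (<-≤-trans p<k k≤i) i<j)))

prefixCount-transpose-after : ∀ {W : ℕ → ℕ} → i < j → j < k → prefixCount (W ∘ transpose i j) k x ≡ prefixCount W k x
prefixCount-transpose-after i<j j<k = ∑-transpose (<-trans i<j j<k) j<k (<⇒≢ i<j)

prefixCount-transpose-between : ∀ {W : ℕ → ℕ} → i < j → i < k → k ≤ j →
  prefixCount (W ∘ transpose i j) k x + 𝟙 (W i <ᵇ x) ≡ prefixCount W k x + 𝟙 (W j <ᵇ x)
prefixCount-transpose-between {i} {j} {k} {x} {W} i<j i<k k≤j = begin
  prefixCount (W ∘ τ) k x + 𝟙 (W i <ᵇ x)     ≡⟨ ∑-update k i<k unchanged ⟩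
  prefixCount W k x + 𝟙 (W (τ i) <ᵇ x)       ≡⟨ cong (λ y → prefixCount W k x + 𝟙 (W y <ᵇ x)) (transpose-ˡ i j) ⟩
  prefixCount W k x + 𝟙 (W j <ᵇ x)           ∎
  where
  open ≡-Reasoning
  τ : ℕ → ℕ
  τ = transpose i j
  unchanged : ∀ p → p < k → p ≢ i → 𝟙 (W (τ p) <ᵇ x) ≡ 𝟙 (W p <ᵇ x)
  unchanged p p<k p≢i = cong (λ y → 𝟙 (W y <ᵇ x)) (transpose-other p≢i (<⇒≢ (<-≤-trans p<k k≤j)))

module _ (w : Word n) {i j : Fin n} (i<j : toℕ i < toℕ j) where
  private
    τ : ℕ → ℕ
    τ = transpose (toℕ i) (toℕ j)
    i≢j : i ≢ j
    i≢j = <⇒≢ i<j ∘ cong toℕ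

  inv-swap : inv (swap w i j) ≡ inversions n (entry w ∘ τ)
  inv-swap = trans (inv≡inversions (swap w i j)) (inversions-cong {n} λ p p<n → entry-swap w i j i≢j p<n)

  prefixCount-swap-outside : k ≤ n → k ≤ toℕ i ⊎ toℕ j < k → ∀ x → prefixCount (entry (swap w i j)) k x ≡ prefixCount (entry w) k x
  prefixCount-swap-outside {k} k≤n outside x = trans (prefixCount-cong {x = x} λ p p<k → entry-swap w i j i≢j (<-≤-trans p<k k≤n)) $
    [ prefixCount-transpose-before {x = x} {entry w} i<j , prefixCount-transpose-after {x = x} {entry w} i<j ]′ outside

  prefixCount-swap-between : toℕ i < k → k ≤ toℕ j → ∀ x →
    prefixCount (entry (swap w i j)) k x + 𝟙 (entry w (toℕ i) <ᵇ x) ≡ prefixCount (entry w) k x + 𝟙 (entry w (toℕ j) <ᵇ x)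
  prefixCount-swap-between {k} i<k k≤j x = trans
    (cong (_+ _) (prefixCount-cong {x = x} λ p p<k → entry-swap w i j i≢j (<-≤-trans p<k (≤-trans k≤j (<⇒≤ (toℕ<n j))))))
    (prefixCount-transpose-between {x = x} {entry w} i<j i<k k≤j)

  bruhat-ascent : IsPerm w → inv (swap w i j) ≡ suc (inv w) → entry w (toℕ i) < entry w (toℕ j)
  bruhat-ascent w-perm ascent with <-cmp (entry w (toℕ i)) (entry w (toℕ j))
  ... | tri< lt _ _ = lt
  ... | tri≈ _ eq _ = contradiction (inj (toℕ<n i) (toℕ<n j) eq) (<⇒≢ i<j)
    where
    inj : InjectiveBelow n (entry w)
    inj = isPerm⇒injectiveBelow w w-perm
  ... | tri> _ _ gt = contradiction (subst (inv w <_) (sym loop) (s≤s (≤-trans (n≤1+n (inv w)) (m≤m+n _ _)))) (<-irrefl refl)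
    where
    open ≡-Reasoning
    K : ℕ
    K = ∑[ m < n ] (inside (toℕ i) (toℕ j) m * 𝟙 ((entry w (toℕ j) <ᵇ entry w m) ∧ (entry w m <ᵇ entry w (toℕ i))))
    loop : inv w ≡ suc (suc (inv w) + 2 * K)
    loop = begin
      inv w                                ≡⟨ inv≡inversions w ⟩
      inversions n (entry w)               ≡⟨ inversions-transpose-descent i<j (toℕ<n j) (isPerm⇒injectiveBelow w w-perm) gt ⟩
      suc (inversions n (entry w ∘ τ) + 2 * K) ≡⟨ cong (λ z → suc (z + 2 * K)) (trans (sym inv-swap) ascent) ⟩
      suc (suc (inv w) + 2 * K)            ∎

edge-isPerm : ∀ {w w′ : Word n} → Edge w w′ → IsPerm w → IsPerm w′
edge-isPerm {w = w} (bruhat  i j i<j refl _) = swap-isPerm w i j (<⇒≢ i<j ∘ cong toℕ)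
edge-isPerm {w = w} (quantum i j i<j refl _) = swap-isPerm w i j (<⇒≢ i<j ∘ cong toℕ)

prefixCount-edge : ∀ {w w′ : Word n} → IsPerm w → (e : Edge w w′) → k ≤ n → ∀ x →
  prefixCount (entry w′) k x ≤ prefixCount (entry w) k x + edgeExp e k
prefixCount-edge {k = k} {w} w-perm (bruhat i j i<j refl ascent) k≤n x with region (toℕ i) (toℕ j) k
... | before k≤i = ≤-trans (≤-reflexive (prefixCount-swap-outside w i<j k≤n (inj₁ k≤i) x)) (m≤m+n _ 0)
... | after  j<k = ≤-trans (≤-reflexive (prefixCount-swap-outside w i<j k≤n (inj₂ j<k) x)) (m≤m+n _ 0)
... | between i<k k≤j = ≤-trans (+-cancelʳ-≤ _ _ _ (begin
  prefixCount (entry (swap w i j)) k x + 𝟙 (entry w (toℕ i) <ᵇ x) ≡⟨ prefixCount-swap-between w i<j i<k k≤j x ⟩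
  prefixCount (entry w) k x + 𝟙 (entry w (toℕ j) <ᵇ x)             ≤⟨ +-monoʳ-≤ _ (𝟙-<-antitoneˡ x (<⇒≤ (bruhat-ascent w i<j w-perm ascent))) ⟩
  prefixCount (entry w) k x + 𝟙 (entry w (toℕ i) <ᵇ x)             ∎)) (m≤m+n _ 0)
  where open ≤-Reasoning
prefixCount-edge {k = k} {w} w-perm (quantum i j i<j refl _) k≤n x with region (toℕ i) (toℕ j) k
... | before k≤i = ≤-trans (≤-reflexive (prefixCount-swap-outside w i<j k≤n (inj₁ k≤i) x)) (m≤m+n _ _)
... | after  j<k = ≤-trans (≤-reflexive (prefixCount-swap-outside w i<j k≤n (inj₂ j<k) x)) (m≤m+n _ _)
... | between i<k k≤j = begin
  prefixCount (entry (swap w i j)) k x                              ≤⟨ m≤m+n _ _ ⟩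
  prefixCount (entry (swap w i j)) k x + 𝟙 (entry w (toℕ i) <ᵇ x) ≡⟨ prefixCount-swap-between w i<j i<k k≤j x ⟩
  prefixCount (entry w) k x + 𝟙 (entry w (toℕ j) <ᵇ x)             ≤⟨ +-monoʳ-≤ _ (𝟙≤1 _) ⟩
  prefixCount (entry w) k x + 1                                     ≡⟨ cong (prefixCount (entry w) k x +_) (inside-between i<k k≤j) ⟨
  prefixCount (entry w) k x + inside (toℕ i) (suc (toℕ j)) k        ∎
  where open ≤-Reasoning

edge-length : ∀ {w w′ : Word n} (e : Edge w w′) → inv w′ + 2 * ∑ n (edgeExp e) ≡ suc (inv w)
edge-length {n} {w′ = w′} (bruhat _ _ _ _ ascent)    = trans (cong (λ s → inv w′ + 2 * s) (∑-zero n λ _ _ → refl)) (trans (+-identityʳ _) ascent)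
edge-length {n} {w′ = w′} (quantum i j _ _ quantum-ℓ) = trans (cong (λ s → inv w′ + 2 * s) (∑-interval (toℕ i) (toℕ<n j))) quantum-ℓ

path-length : ∀ {u v : Word n} (p : Path u v) → len p + inv u ≡ inv v + 2 * ∑ n (pathExp p)
path-length {n} {u} [] = sym (trans (cong (λ s → inv u + 2 * s) (∑-zero n λ _ _ → refl)) (+-identityʳ (inv u)))
path-length {n} {u} {v} (_∷_ {w = w} e p) = begin
  suc (len p + inv u)                  ≡⟨ +-suc (len p) (inv u) ⟨
  len p + suc (inv u)                  ≡⟨ cong (len p +_) (edge-length e) ⟨
  len p + (inv w + 2 * E)              ≡⟨ +-assoc (len p) (inv w) _ ⟨
  len p + inv w + 2 * E                ≡⟨ cong (_+ 2 * E) (path-length p) ⟩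
  inv v + 2 * ∑ n (pathExp p) + 2 * E  ≡⟨ regroup (inv v) (∑ n (pathExp p)) E ⟩
  inv v + 2 * (E + ∑ n (pathExp p))    ≡⟨ cong (λ s → inv v + 2 * s) (∑-distrib-+ n) ⟨
  inv v + 2 * ∑ n (pathExp (e ∷ p))    ∎
  where
  open ≡-Reasoning
  E : ℕ
  E = ∑ n (edgeExp e)
  regroup : ∀ a b c → a + 2 * b + 2 * c ≡ a + 2 * (c + b)
  regroup = solve-∀

path-length-mono : ∀ {u v : Word n} (p p′ : Path u v) → (∀ k → k < n → pathExp p k ≤ pathExp p′ k) → len p ≤ len p′
path-length-mono {n} {u} {v} p p′ le = +-cancelʳ-≤ (inv u) (len p) (len p′) $ begin
  len p + inv u                 ≡⟨ path-length p ⟩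
  inv v + 2 * ∑ n (pathExp p)   ≤⟨ +-monoʳ-≤ (inv v) (*-monoʳ-≤ 2 (∑-mono-≤ n le)) ⟩
  inv v + 2 * ∑ n (pathExp p′)  ≡⟨ path-length p′ ⟨
  len p′ + inv u                ∎
  where open ≤-Reasoning

inv≤n² : (w : Word n) → inv w ≤ n * n
inv≤n² {n} w = begin
  inv w                  ≡⟨ inv≡inversions w ⟩
  inversions n (entry w) ≤⟨ ∑-≤-* n n (λ p _ → ≤-trans (∑-≤-* n 1 λ q _ → 𝟙∧𝟙≤1 q p) (≤-reflexive (*-identityʳ n))) ⟩
  n * n                  ∎
  where
  open ≤-Reasoning
  𝟙∧𝟙≤1 : ∀ q p → 𝟙 (p <ᵇ q) * 𝟙 (entry w q <ᵇ entry w p) ≤ 1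
  𝟙∧𝟙≤1 q p = ≤-trans (*-monoʳ-≤ (𝟙 (p <ᵇ q)) (𝟙≤1 _)) (≤-trans (≤-reflexive (*-identityʳ (𝟙 (p <ᵇ q)))) (𝟙≤1 (p <ᵇ q)))

-- Stated additively: the deficit of W against Y at x is strictly smaller than at y.
prefixCount-exchange : ∀ {W Y : ℕ → ℕ} {y} → i < k → (∀ p → p < i → W p ≡ Y p) →
  (∀ p → i ≤ p → p < k → 𝟙 (Y p <ᵇ x) + 𝟙 (W p <ᵇ y) ≤ 𝟙 (W p <ᵇ x) + 𝟙 (Y p <ᵇ y)) →
  𝟙 (Y i <ᵇ x) + 𝟙 (W i <ᵇ y) < 𝟙 (W i <ᵇ x) + 𝟙 (Y i <ᵇ y) →
  prefixCount Y k x + 1 + prefixCount W k y ≤ prefixCount W k x + prefixCount Y k y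
prefixCount-exchange {i} {k} {x} {W} {Y} {y} i<k agree above strict-at-i = begin
  prefixCount Y k x + 1 + prefixCount W k y ≡⟨ cong (_+ prefixCount W k y) (+-comm (prefixCount Y k x) 1) ⟩
  suc (prefixCount Y k x + prefixCount W k y) ≡⟨ cong suc (∑-distrib-+ k) ⟨
  suc (∑[ p < k ] (𝟙 (Y p <ᵇ x) + 𝟙 (W p <ᵇ y))) ≤⟨ ∑-mono-< i<k pointwise strict-at-i ⟩
  ∑[ p < k ] (𝟙 (W p <ᵇ x) + 𝟙 (Y p <ᵇ y))      ≡⟨ ∑-distrib-+ k ⟩
  prefixCount W k x + prefixCount Y k y         ∎
  where
  open ≤-Reasoning
  pointwise : ∀ p → p < k → 𝟙 (Y p <ᵇ x) + 𝟙 (W p <ᵇ y) ≤ 𝟙 (W p <ᵇ x) + 𝟙 (Y p <ᵇ y)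
  pointwise p p<k with p <? i
  ... | yes p<i rewrite agree p p<i = ≤-refl
  ... | no  p≮i = above p (≮⇒≥ p≮i) p<k

exchange-below : ∀ {W Y : ℕ → ℕ} → i < k → (∀ p → p < i → W p ≡ Y p) → x ≤ Y i →
  (∀ p → i ≤ p → p < k → W p < x ⊎ Y i < W p) →
  prefixCount Y k x + 1 + prefixCount W k (suc (Y i)) ≤ prefixCount W k x + prefixCount Y k (suc (Y i))
exchange-below {i} {k} {x} {W} {Y} i<k agree x≤c outside = prefixCount-exchange {x = x} {y = suc c} i<k agree above strict-at-i
  where
  c : ℕ
  c = Y i
  above : ∀ p → i ≤ p → p < k → 𝟙 (Y p <ᵇ x) + 𝟙 (W p <ᵇ suc c) ≤ 𝟙 (W p <ᵇ x) + 𝟙 (Y p <ᵇ suc c)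
  above p i≤p p<k with outside p i≤p p<k
  ... | inj₁ Wp<x rewrite 𝟙-<-true Wp<x | 𝟙-<-true (s≤s (≤-trans (<⇒≤ Wp<x) x≤c)) =
    subst (_≤ 1 + 𝟙 (Y p <ᵇ suc c)) (+-comm 1 (𝟙 (Y p <ᵇ x))) (+-monoʳ-≤ 1 (𝟙-<-monotoneʳ (Y p) (m≤n⇒m≤1+n x≤c)))
  ... | inj₂ c<Wp rewrite 𝟙-<-false (≤-trans x≤c (<⇒≤ c<Wp)) | 𝟙-<-false c<Wp =
    subst (_≤ 𝟙 (Y p <ᵇ suc c)) (sym (+-identityʳ (𝟙 (Y p <ᵇ x)))) (𝟙-<-monotoneʳ (Y p) (m≤n⇒m≤1+n x≤c))
  strict-at-i : 𝟙 (Y i <ᵇ x) + 𝟙 (W i <ᵇ suc c) < 𝟙 (W i <ᵇ x) + 𝟙 (Y i <ᵇ suc c)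
  strict-at-i rewrite 𝟙-<-false x≤c | 𝟙-<-true (n<1+n c) with outside i ≤-refl i<k
  ... | inj₁ Wi<x rewrite 𝟙-<-true Wi<x | 𝟙-<-true (s≤s (≤-trans (<⇒≤ Wi<x) x≤c)) = ≤-refl
  ... | inj₂ c<Wi rewrite 𝟙-<-false c<Wi = m≤n+m 1 _

exchange-above : ∀ {W Y : ℕ → ℕ} → i < k → (∀ p → p < i → W p ≡ Y p) → Y i < x →
  (∀ p → i ≤ p → p < k → Y i < W p × W p < x) →
  prefixCount Y k x + 1 + prefixCount W k (suc (Y i)) ≤ prefixCount W k x + prefixCount Y k (suc (Y i))
exchange-above {i} {k} {x} {W} {Y} i<k agree c<x window = prefixCount-exchange {x = x} {y = suc c} i<k agree above strict-at-i
  where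
  c : ℕ
  c = Y i
  above : ∀ p → i ≤ p → p < k → 𝟙 (Y p <ᵇ x) + 𝟙 (W p <ᵇ suc c) ≤ 𝟙 (W p <ᵇ x) + 𝟙 (Y p <ᵇ suc c)
  above p i≤p p<k rewrite 𝟙-<-true (proj₂ (window p i≤p p<k)) | 𝟙-<-false (proj₁ (window p i≤p p<k)) =
    subst (_≤ 1 + 𝟙 (Y p <ᵇ suc c)) (sym (+-identityʳ (𝟙 (Y p <ᵇ x)))) (≤-trans (𝟙≤1 _) (m≤m+n 1 _))
  strict-at-i : 𝟙 (Y i <ᵇ x) + 𝟙 (W i <ᵇ suc c) < 𝟙 (W i <ᵇ x) + 𝟙 (Y i <ᵇ suc c)
  strict-at-i rewrite 𝟙-<-true c<x | 𝟙-<-true (n<1+n c) | 𝟙-<-true (proj₂ (window i ≤-refl i<k))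
                    | 𝟙-<-false (proj₁ (window i ≤-refl i<k)) = ≤-refl

∸-≤-∸ : ∀ {a b e} y → b ≤ a + e → y ∸ a ≤ e + (y ∸ b)
∸-≤-∸ {a} {b} {e} y b≤a+e = m≤n+o⇒m∸n≤o y a $ begin
  y                 ≤⟨ m≤n+m∸n y b ⟩
  b + (y ∸ b)       ≤⟨ +-monoˡ-≤ (y ∸ b) b≤a+e ⟩
  a + e + (y ∸ b)   ≡⟨ +-assoc a e (y ∸ b) ⟩
  a + (e + (y ∸ b)) ∎
  where open ≤-Reasoning

+≤+⇒∸≤∸ : ∀ {a b c d} → a + c ≤ b + d → a ∸ b ≤ d ∸ c
+≤+⇒∸≤∸ {a} {b} {c} {d} a+c≤b+d = m≤n+o⇒m∸n≤o a b $ +-cancelʳ-≤ c a (b + (d ∸ c)) $ begin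
  a + c             ≤⟨ a+c≤b+d ⟩
  b + d             ≤⟨ +-monoʳ-≤ b (m≤n+m∸n d c) ⟩
  b + (c + (d ∸ c)) ≡⟨ cong (b +_) (+-comm c (d ∸ c)) ⟩
  b + (d ∸ c + c)   ≡⟨ +-assoc b (d ∸ c) c ⟨
  b + (d ∸ c) + c   ∎
  where open ≤-Reasoning

+≤+⇒∸<∸ : ∀ {a b c d} → a + 1 + c ≤ b + d → c < d → a ∸ b < d ∸ c
+≤+⇒∸<∸ {a} {b} {c} {d} a+1+c≤b+d c<d with b ≤? a
... | yes b≤a = subst (_≤ d ∸ c) (+-∸-assoc 1 b≤a) (+≤+⇒∸≤∸ {suc a} {b} {c} {d} (subst (λ z → z + c ≤ b + d) (+-comm a 1) a+1+c≤b+d))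
... | no  b≰a rewrite m≤n⇒m∸n≡0 (<⇒≤ (≰⇒> b≰a)) = m<n⇒0<n∸m c<d

m≤n⇒m∸1<n : ∀ {a b} → a ≤ b → 0 < b → a ∸ 1 < b
m≤n⇒m∸1<n {zero}  _   0<b = 0<b
m≤n⇒m∸1<n {suc a} a<b _   = a<b

+1+≡suc : ∀ a c → a + 1 + c ≡ suc (a + c)
+1+≡suc = solve-∀

least? : {P : ℕ → Set} → (∀ p → Dec (P p)) → ∀ m →
         (∀ p → p < m → ¬ P p) ⊎ Σ ℕ λ p → p < m × P p × (∀ q → q < p → ¬ P q)
least? P? zero = inj₁ λ _ ()
least? P? (suc m) with least? P? m
... | inj₂ (p , p<m , Pp , below) = inj₂ (p , m<n⇒m<1+n p<m , Pp , below)
... | inj₁ none with P? m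
...   | yes Pm = inj₂ (m , ≤-refl , Pm , none)
...   | no ¬Pm = inj₁ λ p p<1+m → [ none p , (λ { refl → ¬Pm }) ]′ (m<1+n⇒m<n∨m≡n p<1+m)

least : {P : ℕ → Set} → (∀ p → Dec (P p)) → P m → Σ ℕ λ p → p ≤ m × P p × (∀ q → q < p → ¬ P q)
least {m} P? Pm with least? P? (suc m)
... | inj₁ none                     = contradiction Pm (none m ≤-refl)
... | inj₂ (p , p<1+m , Pp , below) = p , ≤-pred p<1+m , Pp , below

argmax : ∀ (W : ℕ → ℕ) → i < j → Σ ℕ λ s → i ≤ s × s < j × (∀ q → i ≤ q → q < j → W q ≤ W s)
argmax {i} {suc j} W i<1+j with m<1+n⇒m<n∨m≡n i<1+j
... | inj₂ refl = i , ≤-refl , ≤-refl , λ q i≤q q<1+i → ≤-reflexive (cong W (≤-antisym (≤-pred q<1+i) i≤q))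
... | inj₁ i<j with argmax W i<j
...   | s , i≤s , s<j , maximal with W s ≤? W j
...     | yes Ws≤Wj = j , <⇒≤ i<j , ≤-refl , λ q i≤q q<1+j →
  [ (λ q<j → ≤-trans (maximal q i≤q q<j) Ws≤Wj) , (λ { refl → ≤-refl }) ]′ (m<1+n⇒m<n∨m≡n q<1+j)
...     | no  Ws≰Wj = s , i≤s , m<n⇒m<1+n s<j , λ q i≤q q<1+j →
  [ maximal q i≤q , (λ { refl → <⇒≤ (≰⇒> Ws≰Wj) }) ]′ (m<1+n⇒m<n∨m≡n q<1+j)

first-difference : (u v : Word n) → u ≢ v →
  Σ ℕ λ i → i < n × entry u i ≢ entry v i × (∀ p → p < i → entry u p ≡ entry v p)
first-difference {n} u v u≢v with least? (λ p → ¬? (entry u p ≟ entry v p)) n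
... | inj₁ none = contradiction (entry-injective u v λ p p<n → decidable-stable (entry u p ≟ entry v p) (none p p<n)) u≢v
... | inj₂ (i , i<n , differ , below) = i , i<n , differ , λ p p<i → decidable-stable (entry u p ≟ entry v p) (below p p<i)

-- Termination: 2·D + N − ℓ drops by exactly one along an edge lowering D = ∑ₖ d_k by its q-degree E.
measure-step : ∀ fuel {D D′ E ι ι′ N} → D′ + E ≡ D → ι′ + 2 * E ≡ suc ι → ι′ ≤ N → 2 * D + N ≡ fuel + ι →
               Σ ℕ λ fuel′ → fuel ≡ suc fuel′ × 2 * D′ + N ≡ fuel′ + ι′
measure-step fuel {D} {D′} {E} {ι} {ι′} {N} D-drop ι-rise ι′≤N measure = settle fuel balance
  where
  regroup : ∀ a e m → suc (2 * a + m) + 2 * e ≡ suc (2 * (a + e) + m)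
  regroup = solve-∀
  balance : suc (2 * D′ + N) ≡ fuel + ι′
  balance = +-cancelʳ-≡ (2 * E) _ _ $ begin
    suc (2 * D′ + N) + 2 * E   ≡⟨ regroup D′ E N ⟩
    suc (2 * (D′ + E) + N)     ≡⟨ cong (λ z → suc (2 * z + N)) D-drop ⟩
    suc (2 * D + N)            ≡⟨ cong suc measure ⟩
    suc (fuel + ι)             ≡⟨ +-suc fuel ι ⟨
    fuel + suc ι               ≡⟨ cong (fuel +_) ι-rise ⟨
    fuel + (ι′ + 2 * E)        ≡⟨ +-assoc fuel ι′ (2 * E) ⟨
    fuel + ι′ + 2 * E          ∎
    where open ≡-Reasoning
  settle : ∀ f → suc (2 * D′ + N) ≡ f + ι′ → Σ ℕ λ f′ → f ≡ suc f′ × 2 * D′ + N ≡ f′ + ι′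
  settle zero     eq = contradiction (≤-trans (≤-reflexive eq) ι′≤N) (<⇒≱ (s≤s (m≤n+m N (2 * D′))))
  settle (suc f′) eq = f′ , refl , suc-injective eq

-- Distance to a fixed target

module DistanceTo (v : Word n) (v-perm : IsPerm v) where

  d : Word n → ℕ → ℕ
  d u k = depth (prefixSet u k) (prefixSet v k)

  deficit : Word n → ℕ → ℕ → ℕ
  deficit u k x = prefixCount (entry v) k x ∸ prefixCount (entry u) k x

  d-lub : ∀ {u c} → IsPerm u → k ≤ n → (∀ x → x ≤ n → deficit u k x ≤ c) → d u k ≤ c
  d-lub {k} {u} {c} u-perm k≤n bounded = depth-lub (prefixSet u k) (prefixSet v k) λ x x≤n →
    subst (_≤ c) (sym (negPart-height u v u-perm v-perm k≤n x)) (bounded x x≤n)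

  deficit≤d : ∀ {u} → IsPerm u → k ≤ n → x ≤ n → deficit u k x ≤ d u k
  deficit≤d {k} {x} {u} u-perm k≤n x≤n =
    subst (_≤ d u k) (negPart-height u v u-perm v-perm k≤n x) (≤-depth (prefixSet u k) (prefixSet v k) x≤n)

  d-edge : ∀ {w w′} → IsPerm w → (e : Edge w w′) → k ≤ n → d w k ≤ edgeExp e k + d w′ k
  d-edge {k} {w} {w′} w-perm e k≤n = d-lub {u = w} w-perm k≤n λ x x≤n → begin
    deficit w k x                ≤⟨ ∸-≤-∸ (prefixCount (entry v) k x) (prefixCount-edge w-perm e k≤n x) ⟩
    edgeExp e k + deficit w′ k x ≤⟨ +-monoʳ-≤ (edgeExp e k) (deficit≤d {u = w′} (edge-isPerm e w-perm) k≤n x≤n) ⟩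
    edgeExp e k + d w′ k         ∎
    where open ≤-Reasoning

  d-target : k ≤ n → d v k ≡ 0
  d-target {k} k≤n = n≤0⇒n≡0 (d-lub {u = v} v-perm k≤n λ x _ → ≤-reflexive (n∸n≡0 (prefixCount (entry v) k x)))

  d≤pathExp : ∀ {u} → IsPerm u → (p : Path u v) → k ≤ n → d u k ≤ pathExp p k
  d≤pathExp u-perm []      k≤n = ≤-reflexive (d-target k≤n)
  d≤pathExp {k} u-perm (e ∷ p) k≤n =
    ≤-trans (d-edge u-perm e k≤n) (+-monoʳ-≤ (edgeExp e k) (d≤pathExp (edge-isPerm e u-perm) p k≤n))


  prefixCount≡⇒d≤ : ∀ {u u′} → IsPerm u → IsPerm u′ → k ≤ n →
                    (∀ x → prefixCount (entry u′) k x ≡ prefixCount (entry u) k x) → d u′ k ≤ d u k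
  prefixCount≡⇒d≤ {k} {u} {u′} u-perm u′-perm k≤n eq = d-lub {u = u′} u′-perm k≤n λ x x≤n →
    subst (λ z → prefixCount (entry v) k x ∸ z ≤ d u k) (sym (eq x)) (deficit≤d {u = u} u-perm k≤n x≤n)

  d-lub-< : ∀ {u c} → IsPerm u → k ≤ n → (∀ x → x ≤ n → deficit u k x < c) → d u k < c
  d-lub-< {c = zero}      u-perm k≤n bounded = contradiction (bounded 0 z≤n) λ ()
  d-lub-< {u = u} {suc c} u-perm k≤n bounded = s≤s (d-lub {u = u} u-perm k≤n λ x x≤n → ≤-pred (bounded x x≤n))

  d-edge-tight : ∀ {w w′} → IsPerm w → (e : Edge w w′) → k ≤ n →
                 d w′ k + edgeExp e k ≤ d w k → d w′ k + edgeExp e k ≡ d w k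
  d-edge-tight {k} {w} {w′} w-perm e k≤n le =
    ≤-antisym le (subst (d w k ≤_) (+-comm (edgeExp e k) (d w′ k)) (d-edge w-perm e k≤n))

  d-swap-outside : ∀ {w} {i j : Fin n} → IsPerm w → toℕ i < toℕ j → k ≤ n → k ≤ toℕ i ⊎ toℕ j < k →
                   d (swap w i j) k ≤ d w k
  d-swap-outside {w = w} {i} {j} w-perm i<j k≤n outside =
    prefixCount≡⇒d≤ {u = w} {swap w i j} w-perm (swap-isPerm w i j (<⇒≢ i<j ∘ cong toℕ) w-perm) k≤n
      (prefixCount-swap-outside w i<j k≤n outside)

  record TightEdge (u : Word n) : Set where
    constructor tight
    field
      {next} : Word n
      edge   : Edge u next
      drop   : ∀ k → k ≤ n → d next k + edgeExp edge k ≡ d u k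

  module BruhatStep {u : Word n} (u-perm : IsPerm u) {i j : Fin n} (i<j : toℕ i < toℕ j)
    (agree : ∀ p → p < toℕ i → entry u p ≡ entry v p)
    (ascent : entry u (toℕ i) < entry u (toℕ j)) (j≤target : entry u (toℕ j) ≤ entry v (toℕ i))
    (no-middle : ∀ m → toℕ i < m → m < toℕ j → entry u (toℕ i) < entry u m → entry v (toℕ i) < entry u m)
    where

    private
      W : ℕ → ℕ
      W = entry u
      c : ℕ
      c = entry v (toℕ i)
      u′ : Word n
      u′ = swap u i j
      u′-perm : IsPerm u′
      u′-perm = swap-isPerm u i j (<⇒≢ i<j ∘ cong toℕ) u-perm

    inv-bruhat : inv u′ ≡ suc (inv u)
    inv-bruhat = begin
      inv u′                                       ≡⟨ inv-swap u i<j ⟩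
      inversions n (W ∘ transpose (toℕ i) (toℕ j)) ≡⟨ inversions-transpose i<j (toℕ<n j) ascent
                                                        (injective⇒distinct (isPerm⇒injectiveBelow u u-perm) (toℕ<n j)) ⟩
      suc (inversions n W + 2 * middle)            ≡⟨ cong (λ K → suc (inversions n W + 2 * K)) no-middle-count ⟩
      suc (inversions n W + 0)                     ≡⟨ cong suc (trans (+-identityʳ _) (sym (inv≡inversions u))) ⟩
      suc (inv u)                                  ∎
      where
      open ≡-Reasoning
      middle : ℕ
      middle = ∑[ m < n ] (inside (toℕ i) (toℕ j) m * 𝟙 ((W (toℕ i) <ᵇ W m) ∧ (W m <ᵇ W (toℕ j))))
      no-middle-count : middle ≡ 0
      no-middle-count = trans (∑-cong n λ m _ → inside-* (λ m i<m m<j →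
          𝟙-between-zero λ Wi<Wm → ≤-trans j≤target (<⇒≤ (no-middle m i<m m<j Wi<Wm))) m)
        (∑-zero n λ m _ → *-zeroʳ (inside (toℕ i) (toℕ j) m))

    edge : Edge u u′
    edge = bruhat i j i<j refl inv-bruhat

    module Between {k} (i<k : toℕ i < k) (k≤j : k ≤ toℕ j) where

      k≤n : k ≤ n
      k≤n = ≤-trans k≤j (<⇒≤ (toℕ<n j))

      Pv Pu Pu′ : ℕ → ℕ
      Pv  = prefixCount (entry v) k
      Pu  = prefixCount W k
      Pu′ = prefixCount (entry u′) k

      shift : ∀ x → Pu′ x + 𝟙 (W (toℕ i) <ᵇ x) ≡ Pu x + 𝟙 (W (toℕ j) <ᵇ x)
      shift = prefixCount-swap-between u i<j i<k k≤j

      unchanged : x ≤ n → Pu′ x ≡ Pu x → Pv x ∸ Pu′ x ≤ d u k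
      unchanged {x} x≤n eq = subst (λ z → Pv x ∸ z ≤ d u k) (sym eq) (deficit≤d {u = u} u-perm k≤n x≤n)

      lowered : W (toℕ i) < x → x ≤ W (toℕ j) → Pv x ∸ Pu′ x ≤ d u k
      lowered {x} Wi<x x≤Wj = ≤-trans (+≤+⇒∸≤∸ {Pv x} {Pu′ x} (≤-pred (subst₂ _≤_ (+1+≡suc (Pv x) _) (+1+≡suc (Pu′ x) _) key)))
                                      (deficit≤d {u = u} u-perm k≤n (entry-< v (toℕ<n i)))
        where
        Pu′+1≡Pu : Pu′ x + 1 ≡ Pu x
        Pu′+1≡Pu = trans (cong (Pu′ x +_) (sym (𝟙-<-true Wi<x)))
                         (trans (shift x) (trans (cong (Pu x +_) (𝟙-<-false x≤Wj)) (+-identityʳ (Pu x))))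
        outside : ∀ p → toℕ i ≤ p → p < k → W p < x ⊎ c < W p
        outside p i≤p p<k with p ≟ toℕ i | W p <? x
        ... | yes refl | _        = inj₁ Wi<x
        ... | no  _    | yes Wp<x = inj₁ Wp<x
        ... | no  p≢i  | no  Wp≮x = inj₂ (no-middle p (≤∧≢⇒< i≤p (p≢i ∘ sym)) (<-≤-trans p<k k≤j) (<-≤-trans Wi<x (≮⇒≥ Wp≮x)))
        key : Pv x + 1 + Pu (suc c) ≤ Pu′ x + 1 + Pv (suc c)
        key = subst (λ z → Pv x + 1 + Pu (suc c) ≤ z + Pv (suc c)) (sym Pu′+1≡Pu)
                    (exchange-below {W = W} {entry v} i<k agree (≤-trans x≤Wj j≤target) outside)

      bound : ∀ x → x ≤ n → Pv x ∸ Pu′ x ≤ d u k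
      bound x x≤n with W (toℕ i) <? x | x ≤? W (toℕ j)
      ... | yes Wi<x | yes x≤Wj = lowered Wi<x x≤Wj
      ... | yes Wi<x | no  x≰Wj = unchanged x≤n $ +-cancelʳ-≡ 1 (Pu′ x) (Pu x) $
        trans (cong (Pu′ x +_) (sym (𝟙-<-true Wi<x))) (trans (shift x) (cong (Pu x +_) (𝟙-<-true (≰⇒> x≰Wj))))
      ... | no  Wi≮x | _        = unchanged x≤n $ +-cancelʳ-≡ 0 (Pu′ x) (Pu x) $
        trans (cong (Pu′ x +_) (sym (𝟙-<-false (≮⇒≥ Wi≮x))))
              (trans (shift x) (cong (Pu x +_) (𝟙-<-false (≤-trans (≮⇒≥ Wi≮x) (<⇒≤ ascent)))))

    d-swap : k ≤ n → d u′ k ≤ d u k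
    d-swap {k} k≤n with region (toℕ i) (toℕ j) k
    ... | before  k≤i     = d-swap-outside {w = u} u-perm i<j k≤n (inj₁ k≤i)
    ... | after   j<k     = d-swap-outside {w = u} u-perm i<j k≤n (inj₂ j<k)
    ... | between i<k k≤j = d-lub {u = u′} u′-perm k≤n (Between.bound i<k k≤j)

    tightEdge : TightEdge u
    tightEdge = tight edge λ k k≤n → d-edge-tight u-perm edge k≤n (subst (_≤ d u k) (sym (+-identityʳ (d u′ k))) (d-swap k≤n))

  module QuantumStep {u : Word n} (u-perm : IsPerm u) (i : ℕ) {s j : Fin n} (i≤s : i ≤ toℕ s) (s<j : toℕ s < toℕ j)
    (agree : ∀ p → p < i → entry u p ≡ entry v p)
    (j≤target : entry u (toℕ j) ≤ entry v i)
    (above-target : ∀ m → i ≤ m → m < toℕ j → entry v i < entry u m)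
    (s-maximal : ∀ m → i ≤ m → m < toℕ j → entry u m ≤ entry u (toℕ s))
    where

    private
      W : ℕ → ℕ
      W = entry u
      c : ℕ
      c = entry v i
      u′ : Word n
      u′ = swap u s j
      u′-perm : IsPerm u′
      u′-perm = swap-isPerm u s j (<⇒≢ s<j ∘ cong toℕ) u-perm
      c<Ws : c < W (toℕ s)
      c<Ws = above-target (toℕ s) i≤s s<j
      Wj<Ws : W (toℕ j) < W (toℕ s)
      Wj<Ws = ≤-<-trans j≤target c<Ws

    inv-quantum : inv u′ + 2 * (toℕ j ∸ toℕ s) ≡ suc (inv u)
    inv-quantum = begin
      inv u′ + 2 * (toℕ j ∸ toℕ s)                                   ≡⟨ cong (λ m → inv u′ + 2 * m) (+-∸-assoc 1 s<j) ⟩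
      inv u′ + 2 * suc (toℕ j ∸ suc (toℕ s))                         ≡⟨ +-2*suc (inv u′) _ ⟩
      suc (suc (inv u′ + 2 * (toℕ j ∸ suc (toℕ s))))                 ≡⟨ cong (λ z → suc (suc (z + 2 * (toℕ j ∸ suc (toℕ s)))))
                                                                          (inv-swap u s<j) ⟩
      suc (suc (inversions n (W ∘ τ) + 2 * (toℕ j ∸ suc (toℕ s))))   ≡⟨ cong (λ K → suc (suc (inversions n (W ∘ τ) + 2 * K)))
                                                                          all-middle ⟨
      suc (suc (inversions n (W ∘ τ) + 2 * middle))                   ≡⟨ cong suc (inversions-transpose-descent s<j (toℕ<n j)
                                                                          (isPerm⇒injectiveBelow u u-perm) Wj<Ws) ⟨
      suc (inversions n W)                                           ≡⟨ cong suc (inv≡inversions u) ⟨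
      suc (inv u)                                                    ∎
      where
      open ≡-Reasoning
      τ : ℕ → ℕ
      τ = transpose (toℕ s) (toℕ j)
      +-2*suc : ∀ a m → a + 2 * suc m ≡ suc (suc (a + 2 * m))
      +-2*suc = solve-∀
      middle : ℕ
      middle = ∑[ m < n ] (inside (toℕ s) (toℕ j) m * 𝟙 ((W (toℕ j) <ᵇ W m) ∧ (W m <ᵇ W (toℕ s))))
      strictly-between : ∀ m → toℕ s < m → m < toℕ j → 𝟙 ((W (toℕ j) <ᵇ W m) ∧ (W m <ᵇ W (toℕ s))) ≡ 1
      strictly-between m s<m m<j = 𝟙-between-one (≤-<-trans j≤target (above-target m i≤m m<j))
        (≤∧≢⇒< (s-maximal m i≤m m<j) (proj₁ (injective⇒distinct (isPerm⇒injectiveBelow u u-perm) (toℕ<n j) m s<m m<j)))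
        where
        i≤m : i ≤ m
        i≤m = ≤-trans i≤s (<⇒≤ s<m)
      all-middle : middle ≡ toℕ j ∸ suc (toℕ s)
      all-middle = begin
        middle                                    ≡⟨ ∑-cong n (λ m _ → inside-* strictly-between m) ⟩
        ∑[ m < n ] (inside (toℕ s) (toℕ j) m * 1) ≡⟨ ∑-cong n (λ m _ → *-identityʳ _) ⟩
        ∑[ m < n ] inside (toℕ s) (toℕ j) m       ≡⟨ ∑-interval (toℕ s) (<⇒≤ (toℕ<n j)) ⟩
        toℕ j ∸ suc (toℕ s)                       ∎

    edge : Edge u u′
    edge = quantum s j s<j refl inv-quantum

    module Between {k} (s<k : toℕ s < k) (k≤j : k ≤ toℕ j) where

      k≤n : k ≤ n
      k≤n = ≤-trans k≤j (<⇒≤ (toℕ<n j))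

      i<k : i < k
      i<k = ≤-<-trans i≤s s<k

      Pv Pu Pu′ : ℕ → ℕ
      Pv  = prefixCount (entry v) k
      Pu  = prefixCount W k
      Pu′ = prefixCount (entry u′) k

      shift : ∀ x → Pu′ x + 𝟙 (W (toℕ s) <ᵇ x) ≡ Pu x + 𝟙 (W (toℕ j) <ᵇ x)
      shift = prefixCount-swap-between u s<j s<k k≤j

      above-c : ∀ p → i ≤ p → p < k → c < W p
      above-c p i≤p p<k = above-target p i≤p (<-≤-trans p<k k≤j)

      positive-at-c : Pu (suc c) < Pv (suc c)
      positive-at-c = subst₂ (λ a b → a + 1 + Pu (suc c) ≤ b + Pv (suc c)) (prefixCount-zero (entry v) k) (prefixCount-zero W k)
                    (exchange-below {W = W} {entry v} i<k agree z≤n λ p i≤p p<k → inj₂ (above-c p i≤p p<k))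

      deficit-at-c : Pv (suc c) ∸ Pu (suc c) ≤ d u k
      deficit-at-c = deficit≤d {u = u} u-perm k≤n (entry-< v (≤-<-trans i≤s (toℕ<n s)))

      unchanged : Pu′ x ≡ Pu x → Pv x + 1 + Pu (suc c) ≤ Pu x + Pv (suc c) → Pv x ∸ Pu′ x < d u k
      unchanged {x} eq key = subst (λ z → Pv x ∸ z < d u k) (sym eq) (<-≤-trans (+≤+⇒∸<∸ key positive-at-c) deficit-at-c)

      raised : x ≤ n → W (toℕ j) < x → x ≤ W (toℕ s) → Pv x ∸ Pu′ x < d u k
      raised {x} x≤n Wj<x x≤Ws = begin-strict
        Pv x ∸ Pu′ x       ≡⟨ cong (Pv x ∸_) Pu′≡Pu+1 ⟩
        Pv x ∸ (Pu x + 1)  ≡⟨ ∸-+-assoc (Pv x) (Pu x) 1 ⟨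
        (Pv x ∸ Pu x) ∸ 1  <⟨ m≤n⇒m∸1<n (deficit≤d {u = u} u-perm k≤n x≤n) (<-≤-trans (m<n⇒0<n∸m positive-at-c) deficit-at-c) ⟩
        d u k              ∎
        where
        open ≤-Reasoning
        Pu′≡Pu+1 : Pu′ x ≡ Pu x + 1
        Pu′≡Pu+1 = trans (sym (+-identityʳ (Pu′ x))) (trans (cong (Pu′ x +_) (sym (𝟙-<-false x≤Ws)))
                         (trans (shift x) (cong (Pu x +_) (𝟙-<-true Wj<x))))

      bound : ∀ x → x ≤ n → Pv x ∸ Pu′ x < d u k
      bound x x≤n with x ≤? W (toℕ j) | x ≤? W (toℕ s)
      ... | yes x≤Wj | _        = unchanged {x}
        (+-cancelʳ-≡ 0 (Pu′ x) (Pu x) (trans (cong (Pu′ x +_) (sym (𝟙-<-false (≤-trans x≤Wj (<⇒≤ Wj<Ws)))))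
                                       (trans (shift x) (cong (Pu x +_) (𝟙-<-false x≤Wj)))))
        (exchange-below {W = W} {entry v} i<k agree (≤-trans x≤Wj j≤target) λ p i≤p p<k → inj₂ (above-c p i≤p p<k))
      ... | no  x≰Wj | yes x≤Ws = raised x≤n (≰⇒> x≰Wj) x≤Ws
      ... | no  x≰Wj | no  x≰Ws = unchanged {x}
        (+-cancelʳ-≡ 1 (Pu′ x) (Pu x) (trans (cong (Pu′ x +_) (sym (𝟙-<-true (≰⇒> x≰Ws))))
                                       (trans (shift x) (cong (Pu x +_) (𝟙-<-true (≰⇒> x≰Wj))))))
        (exchange-above {W = W} {entry v} i<k agree (<-trans c<Ws (≰⇒> x≰Ws)) λ p i≤p p<k →
           above-c p i≤p p<k , ≤-<-trans (s-maximal p i≤p (<-≤-trans p<k k≤j)) (≰⇒> x≰Ws))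

    drops : ∀ k → k ≤ n → d u′ k + edgeExp edge k ≤ d u k
    drops k k≤n with region (toℕ s) (toℕ j) k
    ... | before k≤s = subst (_≤ d u k) (cong (d u′ k +_) (sym (inside-before (suc (toℕ j)) k≤s)))
                             (subst (_≤ d u k) (sym (+-identityʳ _)) (d-swap-outside {w = u} u-perm s<j k≤n (inj₁ k≤s)))
    ... | after  j<k = subst (_≤ d u k) (cong (d u′ k +_) (sym (inside-after (toℕ s) j<k)))
                             (subst (_≤ d u k) (sym (+-identityʳ _)) (d-swap-outside {w = u} u-perm s<j k≤n (inj₂ j<k)))
    ... | between s<k k≤j = subst (_≤ d u k) (trans (+-comm 1 (d u′ k)) (cong (d u′ k +_) (sym (inside-between s<k k≤j))))
                                  (d-lub-< {u = u′} u′-perm (Between.k≤n s<k k≤j) (Between.bound s<k k≤j))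

    tightEdge : TightEdge u
    tightEdge = tight edge λ k k≤n → d-edge-tight u-perm edge k≤n (drops k k≤n)

  bruhat-tightEdge : ∀ {u i j} → IsPerm u → i < n → j < n → i < j →
    (∀ p → p < i → entry u p ≡ entry v p) → entry u i < entry u j → entry u j ≤ entry v i →
    (∀ m → i < m → m < j → entry u i < entry u m → entry v i < entry u m) → TightEdge u
  bruhat-tightEdge u-perm i<n j<n with toFin i<n | toFin j<n
  ... | _ , refl | _ , refl = BruhatStep.tightEdge u-perm

  quantum-tightEdge : ∀ {u} i {s j} → IsPerm u → s < n → j < n → i ≤ s → s < j →
    (∀ p → p < i → entry u p ≡ entry v p) → entry u j ≤ entry v i →
    (∀ m → i ≤ m → m < j → entry v i < entry u m) → (∀ m → i ≤ m → m < j → entry u m ≤ entry u s) → TightEdge u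
  quantum-tightEdge i u-perm s<n j<n with toFin s<n | toFin j<n
  ... | _ , refl | _ , refl = QuantumStep.tightEdge u-perm i

  module Greedy {u : Word n} (u-perm : IsPerm u) {i : ℕ} (i<n : i < n) (differ : entry u i ≢ entry v i)
                (agree : ∀ p → p < i → entry u p ≡ entry v p) {p₀ : ℕ} (p₀<n : p₀ < n) (hit : entry u p₀ ≡ entry v i)
                where

    private
      W : ℕ → ℕ
      W = entry u
      c : ℕ
      c = entry v i

    i<p₀ : i < p₀
    i<p₀ with <-cmp i p₀
    ... | tri< i<p₀ _ _ = i<p₀
    ... | tri≈ _ refl _ = contradiction hit differ
    ... | tri> _ _ p₀<i = contradiction
      (isPerm⇒injectiveBelow v v-perm (<-trans p₀<i i<n) i<n (trans (sym (agree p₀ p₀<i)) hit)) (<⇒≢ p₀<i)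

    ascend : W i < c → TightEdge u
    ascend Wi<c with least {P = λ p → i < p × W i < W p × W p ≤ c} (λ p → i <? p ×-dec W i <? W p ×-dec W p ≤? c)
                           (i<p₀ , subst (W i <_) (sym hit) Wi<c , ≤-reflexive hit)
    ... | j , j≤p₀ , (i<j , Wi<Wj , Wj≤c) , below =
      bruhat-tightEdge u-perm i<n (≤-<-trans j≤p₀ p₀<n) i<j agree Wi<Wj Wj≤c
        λ m i<m m<j Wi<Wm → ≰⇒> λ Wm≤c → below m m<j (i<m , Wi<Wm , Wm≤c)

    descend : c < W i → TightEdge u
    descend c<Wi with least {P = λ p → i < p × W p ≤ c} (λ p → i <? p ×-dec W p ≤? c) (i<p₀ , ≤-reflexive hit)
    ... | j , j≤p₀ , (i<j , Wj≤c) , below with argmax W i<j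
    ...   | s , i≤s , s<j , maximal = quantum-tightEdge i u-perm (<-trans s<j j<n) j<n i≤s s<j agree Wj≤c above maximal
      where
      j<n : j < n
      j<n = ≤-<-trans j≤p₀ p₀<n
      above : ∀ m → i ≤ m → m < j → c < W m
      above m i≤m m<j with m ≟ i
      ... | yes refl = c<Wi
      ... | no  m≢i  = ≰⇒> λ Wm≤c → below m m<j (≤∧≢⇒< i≤m (m≢i ∘ sym) , Wm≤c)

    tightEdge : TightEdge u
    tightEdge with <-cmp (W i) c
    ... | tri< Wi<c _ _ = ascend Wi<c
    ... | tri≈ _ Wi≡c _ = contradiction Wi≡c differ
    ... | tri> _ _ c<Wi = descend c<Wi

  greedy : ∀ {u} → IsPerm u → u ≢ v → TightEdge u
  greedy {u} u-perm u≢v with first-difference u v u≢v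
  ... | i , i<n , differ , agree with isPerm⇒surjective u u-perm (entry-< v i<n)
  ...   | p₀ , p₀<n , hit = Greedy.tightEdge u-perm i<n differ agree p₀<n hit

  D : Word n → ℕ
  D u = ∑ n (d u)

  greedy-path : ∀ fuel {u} → IsPerm u → 2 * D u + n * n ≡ fuel + inv u →
                Σ (Path u v) λ p → ∀ k → k ≤ n → pathExp p k ≡ d u k
  greedy-path fuel {u} u-perm measure with ≡-dec F._≟_ u v
  ... | yes refl = [] , λ k k≤n → sym (d-target k≤n)
  ... | no  u≢v with greedy u-perm u≢v
  ...   | tight {u′} e drop with measure-step fuel {D′ = D u′} D-drop (edge-length e) (inv≤n² u′) measure
    where
    D-drop : D u′ + ∑ n (edgeExp e) ≡ D u
    D-drop = trans (sym (∑-distrib-+ n)) (∑-cong n λ k k<n → drop k (<⇒≤ k<n))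
  ...     | fuel′ , refl , measure′ with greedy-path fuel′ (edge-isPerm e u-perm) measure′
  ...       | p , exact = e ∷ p , λ k k≤n →
    trans (cong (edgeExp e k +_) (exact k k≤n)) (trans (+-comm (edgeExp e k) (d u′ k)) (drop k k≤n))

  tight-path : ∀ {u} → IsPerm u → Σ (Path u v) λ p → ∀ k → k ≤ n → pathExp p k ≡ d u k
  tight-path {u} u-perm = greedy-path (2 * D u + n * n ∸ inv u) u-perm
    (sym (m∸n+n≡m (≤-trans (inv≤n² u) (m≤n+m (n * n) (2 * D u)))))

theorem3p3 : (n : ℕ) (u v : Word n) → IsPerm u → IsPerm v →
    Σ (Path u v) (λ p →
      ((p' : Path u v) → len p ≤ len p')
      × ((p' : Path u v) → len p' ≡ len p →
           (k : ℕ) → 1 ≤ k → k < n → pathExp p k ≤ pathExp p' k)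
      × ((k : ℕ) → 1 ≤ k → k < n →
           pathExp p k ≡ depth (prefixSet u k) (prefixSet v k)))
theorem3p3 n u v u-perm v-perm = path , shortest , (λ p′ _ k _ k<n → minimal p′ k k<n) , (λ k _ k<n → exact k (<⇒≤ k<n))
  where
  open DistanceTo v v-perm
  path : Path u v
  path = proj₁ (tight-path {u} u-perm)
  exact : ∀ k → k ≤ n → pathExp path k ≡ d u k
  exact = proj₂ (tight-path {u} u-perm)
  minimal : (p′ : Path u v) → ∀ k → k < n → pathExp path k ≤ pathExp p′ k
  minimal p′ k k<n = subst (_≤ pathExp p′ k) (sym (exact k (<⇒≤ k<n))) (d≤pathExp u-perm p′ (<⇒≤ k<n))
  shortest : (p′ : Path u v) → len path ≤ len p′
  shortest p′ = path-length-mono path p′ (minimal p′)
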